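{- Let $G=(V,E)$ be a connected input network and let $d\geq 1$ be an integer. There exists a distributed algorithm in the CONGEST model running in $O(2^{2d})$ rounds which outputs either an elimination tree $T$ of $G$ of depth at most $2^d$, or reports that $\mathsf{td}(G)>d$ (and it reports this only when indeed $\mathsf{td}(G)>d$). In the former case, at the end of the algorithm each node $u\in V$ knows its parent and its children in $T$, as well as the depth of $T$.
   Context: CONGEST model: the network is a simple connected $n$-node graph; each node has a unique identifier on $O(\log n)$ bits; computation proceeds in synchronous rounds, in each of which every node sends a message of $O(\log n)$ bits to each neighbor, receives the messages of its neighbors, and performs local computation. Trees are rooted; the depth of a rooted tree is the number of vertices on a longest root-to-leaf path. An elimination tree of $G=(V,E)$ is a rooted tree $T$ on vertex set $V$ such that for every edge $\{u,v\}\in E$, one of $u,v$ is an ancestor of the other in $T$. The treedepth $\mathsf{td}(G)$ is the minimum depth of a rooted forest on $V$ with this ancestor property for all edges. -}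

module Defs where

open import Data.Nat using (ℕ; zero; suc; _+_; _*_; _^_; _≤_; _<_)
open import Data.Nat.Logarithm using (⌈log₂_⌉)
open import Data.Fin using (Fin)
open import Data.Bool using (Bool)
open import Data.List using (List; map; length)
open import Data.List.Membership.Propositional using (_∈_; _∉_)
open import Data.List.Relation.Unary.Unique.Propositional using (Unique)
open import Data.Maybe using (Maybe; just; nothing)
import Data.Maybe as Maybe
open import Data.Product using (Σ; ∃; _×_; _,_)
open import Data.Sum using (_⊎_)
open import Relation.Nullary using (¬_)
open import Relation.Binary.PropositionalEquality using (_≡_)
open import Relation.Binary.Construct.Closure.ReflexiveTransitive using (Star)
open import Function.Bundles using (_⇔_)

-- The order of each neighbour list is arbitrary (a port numbering);
-- statements quantify over all such graphs, hence over all orders.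

record Graph (N : ℕ) : Set where
  field
    nbrs   : Fin N → List (Fin N)
    nodup  : ∀ v → Unique (nbrs v)
    irrefl : ∀ v → v ∉ nbrs v
    sym    : ∀ u v → u ∈ nbrs v → v ∈ nbrs u

open Graph public

Adj : ∀ {N} → Graph N → Fin N → Fin N → Set
Adj G u v = v ∈ nbrs G u

Connected : ∀ {N} → Graph N → Set
Connected G = ∀ u v → Star (Adj G) u v

-- Rooted forests on Fin N, given by a parent function
-- (nothing = root).

data Lvl {N : ℕ} (p : Fin N → Maybe (Fin N)) : Fin N → ℕ → Set where
  root : ∀ {v} → p v ≡ nothing → Lvl p v 1
  up   : ∀ {v u k} → p v ≡ just u → Lvl p u k → Lvl p v (suc k)

-- p is acyclic, i.e. it describes a rooted forest on Fin N
IsForest : ∀ {N} → (Fin N → Maybe (Fin N)) → Set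
IsForest p = ∀ v → ∃ λ k → Lvl p v k

IsTree : ∀ {N} → (Fin N → Maybe (Fin N)) → Set
IsTree {N} p = IsForest p × Σ (Fin N) λ r → p r ≡ nothing × (∀ v → p v ≡ nothing → v ≡ r)

data Anc {N : ℕ} (p : Fin N → Maybe (Fin N)) (u : Fin N) : Fin N → Set where
  here  : Anc p u u
  there : ∀ {v w} → p v ≡ just w → Anc p u w → Anc p u v

-- depth (number of vertices of a longest root-to-leaf path) at most D
DepthAtMost : ∀ {N} → (Fin N → Maybe (Fin N)) → ℕ → Set
DepthAtMost p D = ∀ v k → Lvl p v k → k ≤ D

HasDepth : ∀ {N} → (Fin N → Maybe (Fin N)) → ℕ → Set
HasDepth p D = DepthAtMost p D × ∃ λ v → Lvl p v D

EdgesVertical : ∀ {N} → Graph N → (Fin N → Maybe (Fin N)) → Set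
EdgesVertical G p = ∀ u v → Adj G u v → Anc p u v ⊎ Anc p v u

IsElimForest : ∀ {N} → Graph N → (Fin N → Maybe (Fin N)) → Set
IsElimForest G p = IsForest p × EdgesVertical G p

IsElimTree : ∀ {N} → Graph N → (Fin N → Maybe (Fin N)) → Set
IsElimTree G p = IsTree p × EdgesVertical G p

-- td(G) ≤ d  (td is the minimum depth of an elimination forest)
TdAtMost : ∀ {N} → Graph N → ℕ → Set
TdAtMost {N} G d = Σ (Fin N → Maybe (Fin N)) λ p → IsElimForest G p × DepthAtMost p d

TdGreater : ∀ {N} → Graph N → ℕ → Set
TdGreater G d = ¬ TdAtMost G d

data Output : Set where
  reject : Output
  tree   : Maybe ℕ → List ℕ → ℕ → Output   -- parent ID, children IDs, depth of T

-- A (deterministic) distributed algorithm.  Local computation is an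
-- arbitrary (Agda) function on an arbitrary local state type.
record Algorithm : Set₁ where
  field
    State  : Set
    -- initial state from: number of nodes N, parameter d, own ID,
    -- IDs of the neighbours (in port order)
    init   : ℕ → ℕ → ℕ → List ℕ → State
    -- message (a bit string) sent to the neighbour with the given ID
    send   : State → ℕ → List Bool
    -- new state from old state and the received (sender ID, message)
    -- pairs, in port order
    step   : State → List (ℕ × List Bool) → State
    output : State → Output

open Algorithm public

run : (A : Algorithm) → ∀ {N} → Graph N → (Fin N → ℕ) → ℕ → ℕ → Fin N → State A
run A {N} G ids d zero    v = init A N d (ids v) (map ids (nbrs G v))
run A {N} G ids d (suc t) v =
  step A (run A G ids d t v)
         (map (λ u → ids u , send A (run A G ids d t u) (ids v)) (nbrs G v))

MessagesBounded : (A : Algorithm) → ∀ {N} → Graph N → (Fin N → ℕ) → ℕ → ℕ → ℕ → Set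
MessagesBounded A {N} G ids d R B =
  ∀ t → t < R → ∀ v u → Adj G v u →
    length (send A (run A G ids d t u) (ids v)) ≤ B * (⌈log₂ N ⌉ + 1)

CorrectOutput : ∀ {N} → Graph N → (Fin N → ℕ) → ℕ → (Fin N → Output) → Set
CorrectOutput {N} G ids d out =
  (TdGreater G d × (∀ v → out v ≡ reject))
  ⊎ Σ (Fin N → Maybe (Fin N)) λ p → IsElimTree G p × Σ ℕ λ D →
      HasDepth p D × D ≤ 2 ^ d ×
      (∀ v → Σ (List ℕ) λ cs → out v ≡ tree (Maybe.map ids (p v)) cs D
                 × (∀ x → (x ∈ cs) ⇔ (Σ (Fin N) λ c → p c ≡ just v × ids c ≡ x)))

{-
The algorithm grows a depth-first search tree in L = 2^d phases of L + 1 rounds.  In phase j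
every connected component of the still active vertices floods, for L rounds, the minimum
identifier among its candidates: the active neighbours of the vertex chosen in phase j − 1
(all active vertices in phase 0).  The winner becomes inactive at depth j + 1, with the
previously chosen vertex as parent, so every vertex and its parent are adjacent and the
chain of parents of a vertex is a path of G.

If td(G) ≤ d, an elimination forest of depth d makes consecutive vertices of a path
ancestor-related; the topmost vertex splits the path into two paths hanging strictly
below it, so every simple path of G has fewer than 2^d vertices.  Hence components have
diameter < L, every flood is exact and consistent, and a vertex still active in phase
j + 1 would extend its chain of parents to a path of j + 2 vertices: after L phases all
vertices are settled, and the parent pointers form an elimination tree of depth ≤ L.

A vertex raises an alarm if a flood looks inconsistent (no candidate, or disagreeing
active neighbours) or if it is still active after the last phase; 2L final rounds spread
alarms and the maximum depth.  Alarms thus only arise when td(G) > d.  If a vertex v has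
heard of none, phase 0 was consistent on its 2L-ball, where everybody elected the same
vertex c at distance ≤ L from v; any neighbour z of the ball elected c too, hence lies
within L of c.  So the ball is all of G and nobody raised an alarm.  Without alarms,
phase 0 elected one vertex in all of G, which is the unique root.
-}

module Submission where

open import Data.Bool using (Bool; true; false; if_then_else_; _∧_; _∨_; not)
open import Data.Bool.Properties using (T-≡; ∨-zeroʳ; ∨-conicalˡ; ∨-conicalʳ; ∧-conicalʳ) renaming (_≟_ to _≟ᴮ_)
open import Data.Empty using (⊥; ⊥-elim)
open import Data.Fin using (Fin; zero; suc) renaming (_≟_ to _≟ᶠ_)
open import Data.Fin.Properties using (injective⇒≤; any?)
open import Data.List using (List; []; _∷_; _++_; length; lookup; take; drop; map; find)
open import Data.List.Properties using (length-++; map-∘; map-cong)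
open import Data.List.Membership.Propositional using (_∈_; _∉_)
open import Data.List.Membership.Propositional.Properties using (∈-lookup; ∈-∃++; ∈-++⁺ˡ; ∈-++⁺ʳ; ∈-map⁺; ∈-map⁻)
open import Data.List.Relation.Unary.Any using (here; there)
open import Data.List.Relation.Unary.All as All using (All; []; _∷_)
open import Data.List.Relation.Unary.All.Properties using (¬Any⇒All¬; ++⁻ˡ)
open import Data.List.Relation.Unary.AllPairs using ([]; _∷_)
open import Data.List.Relation.Unary.Unique.Propositional using (Unique)
open import Data.List.Relation.Unary.Linked as Linked using (Linked; []; [-]; _∷_)
open import Data.Maybe using (Maybe; just; nothing)
import Data.Maybe as Maybe
open import Data.Maybe.Properties using (just-injective)
open import Data.Nat using (ℕ; zero; suc; pred; _+_; _*_; _∸_; _^_; _≤_; _<_; _⊓_; _⊔_; _≡ᵇ_; _<ᵇ_; z≤n; s≤s; ⌈_/2⌉; ⌊_/2⌋; _/_; _%_; >-nonZero)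
open import Data.Nat.Properties
open import Data.Nat.DivMod using (m%n<n; m<n*o⇒m/o<n; m≡m%n+[m/n]*n)
open import Data.Nat.Induction using (<-wellFounded)
open import Data.Nat.Logarithm using (⌈log₂_⌉)
open import Data.Nat.Logarithm.Core using (⌈log2⌉)
open import Data.List.Membership.DecPropositional _≟_ using (_∈?_)
open import Data.Product using (Σ; _×_; _,_; proj₁; proj₂)
import Data.Product as Product
open import Data.Sum using (_⊎_; inj₁; inj₂)
open import Data.Unit using (⊤; tt)
open import Data.Vec using (Vec; []; _∷_)
import Data.Vec as Vec
open import Function using (_∘_)
open import Function.Bundles using (Equivalence; _⇔_; mk⇔)
open import Function.Definitions using (Injective)
open import Induction.WellFounded using (Acc; acc)
open import Relation.Binary.Construct.Closure.ReflexiveTransitive using (Star; ε; _◅_)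
open import Relation.Binary.PropositionalEquality
open import Relation.Nullary using (¬_; Dec; does; yes; no)
open import Relation.Nullary.Decidable using (dec-true)

open import Defs hiding (sym)

≡⇒≡ᵇ≡true : ∀ {m n} → m ≡ n → (m ≡ᵇ n) ≡ true
≡⇒≡ᵇ≡true {m} {n} m≡n = Equivalence.to T-≡ (≡⇒≡ᵇ m n m≡n)

≡ᵇ≡true⇒≡ : ∀ {m n} → (m ≡ᵇ n) ≡ true → m ≡ n
≡ᵇ≡true⇒≡ {m} {n} e = ≡ᵇ⇒≡ m n (Equivalence.from T-≡ e)

≢⇒≡ᵇ≡false : ∀ {m n} → m ≢ n → (m ≡ᵇ n) ≡ false
≢⇒≡ᵇ≡false {m} {n} m≢n with m ≡ᵇ n in e
... | true  = ⊥-elim (m≢n (≡ᵇ≡true⇒≡ e))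
... | false = refl

<⇒<ᵇ≡true : ∀ {m n} → m < n → (m <ᵇ n) ≡ true
<⇒<ᵇ≡true {m} {n} m<n = Equivalence.to T-≡ (<⇒<ᵇ m<n)

≤⇒<ᵇ≡false : ∀ {m n} → n ≤ m → (m <ᵇ n) ≡ false
≤⇒<ᵇ≡false {m} {n} n≤m with m <ᵇ n in e
... | true  = ⊥-elim (<⇒≱ (<ᵇ⇒< m n (Equivalence.from T-≡ e)) n≤m)
... | false = refl

does≡true⇒ : ∀ {A : Set} (a? : Dec A) → does a? ≡ true → A
does≡true⇒ (yes a) _ = a

true≢false : true ≢ false
true≢false ()

Bool-dichotomy : ∀ b → b ≡ true ⊎ b ≡ false
Bool-dichotomy true  = inj₁ refl
Bool-dichotomy false = inj₂ refl

∨-trueˡ : ∀ {a} b → a ≡ true → a ∨ b ≡ true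
∨-trueˡ b refl = refl

∨-trueʳ : ∀ a {b} → b ≡ true → a ∨ b ≡ true
∨-trueʳ a refl = ∨-zeroʳ a

∨≡true⇒ : ∀ a b → a ∨ b ≡ true → a ≡ true ⊎ b ≡ true
∨≡true⇒ true  b _ = inj₁ refl
∨≡true⇒ false b e = inj₂ e

if-true : {A : Set} {b : Bool} {x y : A} → b ≡ true → (if b then x else y) ≡ x
if-true refl = refl

if-false : {A : Set} {b : Bool} {x y : A} → b ≡ false → (if b then x else y) ≡ y
if-false refl = refl

n≤2^⌈log2⌉ : ∀ n (rec : Acc _<_ n) → n ≤ 2 ^ ⌈log2⌉ n rec
n≤2^⌈log2⌉ zero          _        = z≤n
n≤2^⌈log2⌉ (suc zero)    _        = s≤s z≤n
n≤2^⌈log2⌉ (suc (suc n)) (acc rs) = begin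
  2 + n                     ≤⟨ +-monoʳ-≤ 2 n≤2*⌈n/2⌉ ⟩
  2 + 2 * ⌈ n /2⌉            ≡⟨ *-suc 2 ⌈ n /2⌉ ⟨
  2 * suc ⌈ n /2⌉            ≤⟨ *-monoʳ-≤ 2 (n≤2^⌈log2⌉ (suc ⌈ n /2⌉) _) ⟩
  2 ^ ⌈log2⌉ (2 + n) (acc rs) ∎
  where
  open ≤-Reasoning
  n≤2*⌈n/2⌉ : n ≤ 2 * ⌈ n /2⌉
  n≤2*⌈n/2⌉ = begin
    n                         ≡⟨ ⌊n/2⌋+⌈n/2⌉≡n n ⟨
    ⌊ n /2⌋ + ⌈ n /2⌉         ≤⟨ +-monoˡ-≤ ⌈ n /2⌉ (⌊n/2⌋≤⌈n/2⌉ n) ⟩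
    ⌈ n /2⌉ + ⌈ n /2⌉         ≡⟨ cong (⌈ n /2⌉ +_) (+-identityʳ ⌈ n /2⌉) ⟨
    2 * ⌈ n /2⌉               ∎

n≤2^⌈log₂n⌉ : ∀ n → n ≤ 2 ^ ⌈log₂ n ⌉
n≤2^⌈log₂n⌉ n = n≤2^⌈log2⌉ n (<-wellFounded n)

bit : Bool → ℕ
bit b = if b then 1 else 0

toBits : ℕ → ℕ → List Bool
toBits zero    x = []
toBits (suc w) x = (x % 2 ≡ᵇ 1) ∷ toBits w (x / 2)

fromBits : List Bool → ℕ
fromBits []       = 0
fromBits (b ∷ bs) = bit b + 2 * fromBits bs

length-toBits : ∀ w x → length (toBits w x) ≡ w
length-toBits zero    x = refl
length-toBits (suc w) x = cong suc (length-toBits w (x / 2))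

fromBits-toBits : ∀ w {x} → x < 2 ^ w → fromBits (toBits w x) ≡ x
fromBits-toBits zero    {zero}  _         = refl
fromBits-toBits zero    {suc x} (s≤s ())
fromBits-toBits (suc w) {x} x<2^1+w = begin
  bit (x % 2 ≡ᵇ 1) + 2 * fromBits (toBits w (x / 2))
    ≡⟨ cong₂ _+_ (bit-parity (x % 2) (m%n<n x 2)) (cong (2 *_) (fromBits-toBits w x/2<2^w)) ⟩
  x % 2 + 2 * (x / 2)  ≡⟨ cong (x % 2 +_) (*-comm 2 (x / 2)) ⟩
  x % 2 + x / 2 * 2    ≡⟨ sym (m≡m%n+[m/n]*n x 2) ⟩
  x                    ∎
  where
  open ≡-Reasoning
  bit-parity : ∀ r → r < 2 → bit (r ≡ᵇ 1) ≡ r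
  bit-parity zero       _ = refl
  bit-parity (suc zero) _ = refl
  bit-parity (suc (suc r)) (s≤s (s≤s ()))
  x/2<2^w : x / 2 < 2 ^ w
  x/2<2^w = m<n*o⇒m/o<n (subst (x <_) (*-comm 2 (2 ^ w)) x<2^1+w)

encode : ∀ w {c} → Vec ℕ c → List Bool
encode w []       = []
encode w (x ∷ xs) = toBits w x ++ encode w xs

decode : ∀ w c → List Bool → Vec ℕ c
decode w zero    bs = []
decode w (suc c) bs = fromBits (take w bs) ∷ decode w c (drop w bs)

take-++-exact : ∀ {A : Set} {w} (xs : List A) {ys} → length xs ≡ w → take w (xs ++ ys) ≡ xs
take-++-exact []       refl = refl
take-++-exact (x ∷ xs) refl = cong (x ∷_) (take-++-exact xs refl)

drop-++-exact : ∀ {A : Set} {w} (xs : List A) {ys} → length xs ≡ w → drop w (xs ++ ys) ≡ ys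
drop-++-exact []       refl = refl
drop-++-exact (x ∷ xs) refl = drop-++-exact xs refl

decode-encode : ∀ w {c} (xs : Vec ℕ c) → decode w c (encode w xs) ≡ Vec.map (fromBits ∘ toBits w) xs
decode-encode w []       = refl
decode-encode w (x ∷ xs) = cong₂ _∷_
  (cong fromBits (take-++-exact (toBits w x) (length-toBits w x)))
  (trans (cong (decode w _) (drop-++-exact (toBits w x) (length-toBits w x))) (decode-encode w xs))

length-encode : ∀ w {c} (xs : Vec ℕ c) → length (encode w xs) ≡ c * w
length-encode w []       = refl
length-encode w (x ∷ xs) = trans (length-++ (toBits w x)) (cong₂ _+_ (length-toBits w x) (length-encode w xs))

data Reach {X : Set} (E : X → X → Set) : ℕ → X → X → Set where
  stay : ∀ {k x} → Reach E k x x
  move : ∀ {k x y z} → E x y → Reach E k y z → Reach E (suc k) x z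

module _ {X : Set} {E : X → X → Set} where

  Reach-weaken : ∀ {k k′ x y} → k ≤ k′ → Reach E k x y → Reach E k′ x y
  Reach-weaken _         stay       = stay
  Reach-weaken (s≤s k≤k′) (move e r) = move e (Reach-weaken k≤k′ r)

  Reach-snoc : ∀ {k x y z} → Reach E k x y → E y z → Reach E (suc k) x z
  Reach-snoc stay        e = move e stay
  Reach-snoc (move e′ r) e = move e′ (Reach-snoc r e)

  Reach-++ : ∀ {a b x y z} → Reach E a x y → Reach E b y z → Reach E (a + b) x z
  Reach-++ {a} {b} stay r′ = Reach-weaken (m≤n+m b a) r′
  Reach-++ (move e r) r′   = move e (Reach-++ r r′)

  Reach-reverse : (∀ {x y} → E x y → E y x) → ∀ {k x y} → Reach E k x y → Reach E k y x
  Reach-reverse E-sym stay       = stay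
  Reach-reverse E-sym (move e r) = Reach-snoc (Reach-reverse E-sym r) (E-sym e)

  Reach-map : {E′ : X → X → Set} → (∀ {x y} → E x y → E′ x y) → ∀ {k x y} → Reach E k x y → Reach E′ k x y
  Reach-map f stay       = stay
  Reach-map f (move e r) = move (f e) (Reach-map f r)

infixr 5 _◅_

data Path {X : Set} (E : X → X → Set) : X → X → List X → Set where
  [_] : ∀ x → Path E x x (x ∷ [])
  _◅_ : ∀ {x y z xs} → E x y → Path E y z xs → Path E x z (x ∷ xs)

module _ {N : ℕ} {E : Fin N → Fin N → Set} where
  open import Data.List.Membership.DecPropositional (_≟ᶠ_ {N}) using () renaming (_∈?_ to _∈ᶠ?_)

  Path-suffix : ∀ {x y z xs} → Path E y z xs → Unique xs → x ∈ xs → Σ (List (Fin N)) λ ys → Path E x z ys × Unique ys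
  Path-suffix [ _ ]     u          (here refl) = _ , [ _ ] , u
  Path-suffix (e ◅ p)   u          (here refl) = _ , e ◅ p , u
  Path-suffix (e ◅ p)   (_ ∷ u)    (there x∈) = Path-suffix p u x∈

  Reach⇒simplePath : ∀ {k x y} → Reach E k x y → Σ (List (Fin N)) λ xs → Path E x y xs × Unique xs
  Reach⇒simplePath stay = _ , [ _ ] , [] ∷ []
  Reach⇒simplePath {x = x} (move e r) with Reach⇒simplePath r
  ... | xs , p , u with x ∈ᶠ? xs
  ...   | yes x∈ = Path-suffix p u x∈
  ...   | no  x∉ = x ∷ xs , e ◅ p , ¬Any⇒All¬ xs x∉ ∷ u

Path⇒Reach : ∀ {X : Set} {E : X → X → Set} {k x z xs} → Path E x z xs → length xs ≤ suc k → Reach E k x z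
Path⇒Reach         [ _ ]           _         = stay
Path⇒Reach {k = suc k} (e ◅ p)     (s≤s len≤) = move e (Path⇒Reach p len≤)
Path⇒Reach {k = zero}  (e ◅ [ _ ]) (s≤s ())
Path⇒Reach {k = zero}  (e ◅ _ ◅ _) (s≤s ())

Path⇒Linked : ∀ {X : Set} {E : X → X → Set} {x z xs} → Path E x z xs → Linked E xs
Path⇒Linked [ _ ]           = [-]
Path⇒Linked (e ◅ [ _ ])     = e ∷ [-]
Path⇒Linked (e ◅ e′ ◅ p)    = e ∷ Path⇒Linked (e′ ◅ p)

Unique⇒lookup-injective : ∀ {N} (xs : List (Fin N)) → Unique xs → ∀ i j → lookup xs i ≡ lookup xs j → i ≡ j
Unique⇒lookup-injective (x ∷ xs) u       zero    zero    e = refl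
Unique⇒lookup-injective (x ∷ xs) (a ∷ u) zero    (suc j) e = ⊥-elim (All.lookup a (∈-lookup j) e)
Unique⇒lookup-injective (x ∷ xs) (a ∷ u) (suc i) zero    e = ⊥-elim (All.lookup a (∈-lookup i) (sym e))
Unique⇒lookup-injective (x ∷ xs) (a ∷ u) (suc i) (suc j) e = cong suc (Unique⇒lookup-injective xs u i j e)

Unique⇒length≤ : ∀ {N} (xs : List (Fin N)) → Unique xs → length xs ≤ N
Unique⇒length≤ xs u = injective⇒≤ (λ {i} {j} → Unique⇒lookup-injective xs u i j)

-- Paths in graphs of bounded treedepth

module Forest {N : ℕ} (q : Fin N → Maybe (Fin N)) where

  Lvl-functional : ∀ {v a b} → Lvl q v a → Lvl q v b → a ≡ b
  Lvl-functional (root _)  (root _)   = refl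
  Lvl-functional (root e)  (up e′ _)  with () ← trans (sym e) e′
  Lvl-functional (up e _)  (root e′)  with () ← trans (sym e) e′
  Lvl-functional (up e l)  (up e′ l′) with refl ← just-injective (trans (sym e) e′) = cong suc (Lvl-functional l l′)

  Lvl⇒root : ∀ {v m} → Lvl q v m → Σ (Fin N) λ r → q r ≡ nothing
  Lvl⇒root (root e) = _ , e
  Lvl⇒root (up _ l) = Lvl⇒root l

  Lvl-positive : ∀ {v a} → Lvl q v a → 1 ≤ a
  Lvl-positive (root _) = s≤s z≤n
  Lvl-positive (up _ _) = s≤s z≤n

  Anc⇒≡⊎Lvl< : ∀ {a b la lb} → Anc q a b → Lvl q a la → Lvl q b lb → a ≡ b ⊎ la < lb
  Anc⇒≡⊎Lvl< here           _  _         = inj₁ refl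
  Anc⇒≡⊎Lvl< (there e a≤w)  la (root e′) with () ← trans (sym e) e′
  Anc⇒≡⊎Lvl< (there e a≤w)  la (up e′ lw) with refl ← just-injective (trans (sym e) e′) with Anc⇒≡⊎Lvl< a≤w la lw
  ... | inj₁ refl = inj₂ (≤-reflexive (cong suc (Lvl-functional la lw)))
  ... | inj₂ lt   = inj₂ (<-trans lt (n<1+n _))

  Anc-trans : ∀ {a b c} → Anc q a b → Anc q b c → Anc q a c
  Anc-trans ab here         = ab
  Anc-trans ab (there e bc) = there e (Anc-trans ab bc)

  Anc-comparable : ∀ {a b x} → Anc q a x → Anc q b x → Anc q a b ⊎ Anc q b a
  Anc-comparable here         bx            = inj₂ bx
  Anc-comparable (there e ax) here          = inj₁ (there e ax)
  Anc-comparable (there e ax) (there e′ bx) with refl ← just-injective (trans (sym e) e′) = Anc-comparable ax bx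

  Comparable : Fin N → Fin N → Set
  Comparable a b = Anc q a b ⊎ Anc q b a

  topmost : ∀ x xs → Linked Comparable (x ∷ xs) → Σ (Fin N) λ t → t ∈ x ∷ xs × All (Anc q t) (x ∷ xs)
  topmost x []       _           = x , here refl , here ∷ []
  topmost x (y ∷ xs) (x~y ∷ lk) with topmost y xs lk
  ... | t , t∈ , t≤ with x~y
  ...   | inj₂ y≤x = t , there t∈ , Anc-trans (All.lookup t≤ (here refl)) y≤x ∷ t≤
  ...   | inj₁ x≤y with Anc-comparable (All.lookup t≤ (here refl)) x≤y
  ...     | inj₁ t≤x = t , there t∈ , t≤x ∷ t≤
  ...     | inj₂ x≤t = x , here refl , here ∷ All.map (Anc-trans x≤t) t≤

  module _ {R : Fin N → Fin N → Set} where

    Linked-++⁻ˡ : ∀ xs {ys} → Linked R (xs ++ ys) → Linked R xs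
    Linked-++⁻ˡ []           _        = []
    Linked-++⁻ˡ (x ∷ [])     _        = [-]
    Linked-++⁻ˡ (x ∷ y ∷ xs) (r ∷ lk) = r ∷ Linked-++⁻ˡ (y ∷ xs) lk

    Linked-++⁻ʳ : ∀ xs {ys} → Linked R (xs ++ ys) → Linked R ys
    Linked-++⁻ʳ []           lk       = lk
    Linked-++⁻ʳ (x ∷ [])     {[]}     _        = []
    Linked-++⁻ʳ (x ∷ [])     {y ∷ ys} (r ∷ lk) = lk
    Linked-++⁻ʳ (x ∷ y ∷ xs) (r ∷ lk) = Linked-++⁻ʳ (y ∷ xs) lk

  Unique-++⁻ˡ : ∀ (xs : List (Fin N)) {ys} → Unique (xs ++ ys) → Unique xs
  Unique-++⁻ˡ []       _       = []
  Unique-++⁻ˡ (x ∷ xs) (a ∷ u) = ++⁻ˡ xs a ∷ Unique-++⁻ˡ xs u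

  Unique-++⁻ʳ : ∀ (xs : List (Fin N)) {ys} → Unique (xs ++ ys) → Unique ys
  Unique-++⁻ʳ []       u       = u
  Unique-++⁻ʳ (x ∷ xs) (a ∷ u) = Unique-++⁻ʳ xs u

  Unique-++-∷⁻ˡ : ∀ (xs : List (Fin N)) t ys → Unique (xs ++ t ∷ ys) → t ∉ xs
  Unique-++-∷⁻ˡ (x ∷ xs) t ys (a ∷ u) (here refl) = All.lookup a (∈-++⁺ʳ xs (here refl)) refl
  Unique-++-∷⁻ˡ (x ∷ xs) t ys (a ∷ u) (there t∈)  = Unique-++-∷⁻ˡ xs t ys u t∈

  Unique-++-∷⁻ʳ : ∀ (xs : List (Fin N)) t ys → Unique (xs ++ t ∷ ys) → t ∉ ys
  Unique-++-∷⁻ʳ xs t ys u t∈ with Unique-++⁻ʳ xs u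
  ... | a ∷ _ = All.lookup a t∈ refl

  module DepthBound (d : ℕ) (depth≤d : DepthAtMost q d) (forest : IsForest q) where

    level : Fin N → ℕ
    level v = proj₁ (forest v)

    level-Lvl : ∀ v → Lvl q v (level v)
    level-Lvl v = proj₂ (forest v)

    Anc⇒level< : ∀ {a b} → Anc q a b → a ≢ b → level a < level b
    Anc⇒level< a≤b a≢b with Anc⇒≡⊎Lvl< a≤b (level-Lvl _) (level-Lvl _)
    ... | inj₁ a≡b = ⊥-elim (a≢b a≡b)
    ... | inj₂ lt  = lt

    -- The topmost vertex t of the chain splits it into two chains whose topmost vertices lie strictly below t.
    chain-below-length< : ∀ h xs → Unique xs → Linked Comparable xs → ∀ t → t ∈ xs → All (Anc q t) xs →
                          d < level t + h → length xs < 2 ^ h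
    chain-below-length< zero xs _ _ t _ _ d<t+0 =
      ⊥-elim (<⇒≱ (subst (d <_) (+-identityʳ _) d<t+0) (depth≤d t _ (level-Lvl t)))
    chain-below-length< (suc h) xs u lk t t∈ t≤ d<t+h with ∈-∃++ t∈
    ... | ls , rs , refl = begin-strict
      length (ls ++ t ∷ rs)    ≡⟨ length-++ ls ⟩
      length ls + suc (length rs) <⟨ +-mono-≤ (part ls (Unique-++⁻ˡ ls u) (Linked-++⁻ˡ ls lk) (∈-++⁺ˡ) (Unique-++-∷⁻ˡ ls t rs u))
                                              (part rs rs-unique (Linked-++⁻ʳ (t ∷ []) (Linked-++⁻ʳ ls lk)) (∈-++⁺ʳ ls ∘ there) (Unique-++-∷⁻ʳ ls t rs u)) ⟩
      2 ^ h + 2 ^ h            ≡⟨ cong (2 ^ h +_) (+-identityʳ (2 ^ h)) ⟨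
      2 ^ suc h                ∎
      where
      open ≤-Reasoning
      rs-unique : Unique rs
      rs-unique with Unique-++⁻ʳ ls u
      ... | _ ∷ u′ = u′
      part : ∀ zs → Unique zs → Linked Comparable zs → (∀ {z} → z ∈ zs → z ∈ ls ++ t ∷ rs) → t ∉ zs → length zs < 2 ^ h
      part []       _  _  _   _   = m^n>0 2 h
      part (z ∷ zs) uz lz zs⊆ t∉ with topmost z zs lz
      ... | t′ , t′∈ , t′≤ = chain-below-length< h (z ∷ zs) uz lz t′ t′∈ t′≤ (<-≤-trans d<t+h (begin
        level t + suc h  ≡⟨ +-suc (level t) h ⟩
        suc (level t) + h ≤⟨ +-monoˡ-≤ h (Anc⇒level< (All.lookup t≤ (zs⊆ t′∈)) t≢t′) ⟩
        level t′ + h     ∎))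
        where
        t≢t′ : t ≢ t′
        t≢t′ refl = t∉ t′∈

    chain-length<2^d : ∀ xs → Unique xs → Linked Comparable xs → length xs < 2 ^ d
    chain-length<2^d []       _ _  = m^n>0 2 d
    chain-length<2^d (x ∷ xs) u lk with topmost x xs lk
    ... | t , t∈ , t≤ = chain-below-length< d (x ∷ xs) u lk t t∈ t≤ (+-monoˡ-≤ d (Lvl-positive (level-Lvl t)))

-- The algorithm

record Message : Set where
  constructor message
  field
    senderActive : Bool
    senderBest   : ℕ
    toParent     : Bool
    senderAlarm  : Bool
    senderHeight : ℕ

open Message public

Inbox : Set
Inbox = List (ℕ × Message)

record NodeState : Set where
  field
    size       : ℕ
    depthBound : ℕ
    myId       : ℕ
    nbrIds     : List ℕ
    phase      : ℕ
    tick       : ℕ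
    active     : Bool
    prevChosen : ℕ
    best       : ℕ
    parentId   : ℕ
    depth      : ℕ
    failed     : Bool
    childIds   : List ℕ
    alarm      : Bool
    height     : ℕ

open NodeState public

data Stage : Set where
  flooding transition final : Stage

atStage : {A : Set} → Stage → A → A → A → A
atStage flooding   a b c = a
atStage transition a b c = b
atStage final      a b c = c

atStage-elim : {A : Set} (P : A → Set) → ∀ g {a b c} → P a → P b → P c → P (atStage g a b c)
atStage-elim P flooding   pa pb pc = pa
atStage-elim P transition pa pb pc = pb
atStage-elim P final      pa pb pc = pc

minActive : ℕ → Inbox → ℕ
minActive x []             = x
minActive x ((_ , m) ∷ ms) = if senderActive m then senderBest m ⊓ minActive x ms else minActive x ms

disagrees : ℕ → Inbox → Bool
disagrees x []             = false
disagrees x ((_ , m) ∷ ms) = (senderActive m ∧ not (senderBest m ≡ᵇ x)) ∨ disagrees x ms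

anyAlarm : Inbox → Bool
anyAlarm []             = false
anyAlarm ((_ , m) ∷ ms) = senderAlarm m ∨ anyAlarm ms

maxHeight : Inbox → ℕ
maxHeight []             = 0
maxHeight ((_ , m) ∷ ms) = senderHeight m ⊔ maxHeight ms

childrenIn : Inbox → List ℕ
childrenIn []             = []
childrenIn ((i , m) ∷ ms) = if toParent m then i ∷ childrenIn ms else childrenIn ms

module Protocol (k : ℕ) where

  -- identifiers are below N ^ k, so N ^ k names no vertex
  sentinel : NodeState → ℕ
  sentinel s = size s ^ k

  phases : NodeState → ℕ
  phases s = 2 ^ depthBound s

  stage : NodeState → Stage
  stage s = if phase s <ᵇ phases s then (if tick s <ᵇ phases s then flooding else transition) else final

  chosen : NodeState → Bool
  chosen s = active s ∧ (best s ≡ᵇ myId s)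

  candidate : NodeState → ℕ → Bool
  candidate s c = (c ≡ᵇ sentinel s) ∨ does (c ∈? nbrIds s)

  floodStep : NodeState → Inbox → NodeState
  floodStep s ms = record s
    { tick = suc (tick s)
    ; best = if active s then minActive (best s) ms else best s
    }

  transitionStep : NodeState → Inbox → NodeState
  transitionStep s ms = record s
    { phase      = suc (phase s)
    ; tick       = 0
    ; active     = active′
    ; prevChosen = prevChosen′
    ; best       = if active′ ∧ candidate s prevChosen′ then myId s else sentinel s
    ; parentId   = if chosen s then prevChosen s else parentId s
    ; depth      = depth′
    ; failed     = failed′
    ; alarm      = failed′ ∨ active′        -- what counts is its value after the last phase
    ; height     = depth′
    }
    where
    active′ = active s ∧ not (chosen s)
    prevChosen′ = if active s then best s else prevChosen s
    depth′ = if chosen s then suc (phase s) else depth s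
    failed′ = failed s ∨ (active s ∧ ((best s ≡ᵇ sentinel s) ∨ disagrees (best s) ms))

  finalStep : NodeState → Inbox → NodeState
  finalStep s ms = record s
    { alarm    = alarm s ∨ anyAlarm ms
    ; height   = height s ⊔ maxHeight ms
    ; childIds = childrenIn ms
    }

  step′ : NodeState → Inbox → NodeState
  step′ s ms = atStage (stage s) (floodStep s ms) (transitionStep s ms) (finalStep s ms)

  initial : ℕ → ℕ → ℕ → List ℕ → NodeState
  initial N d i ns = record
    { size = N ; depthBound = d ; myId = i ; nbrIds = ns
    ; phase = 0 ; tick = 0 ; active = true ; prevChosen = N ^ k ; best = i
    ; parentId = N ^ k ; depth = 0 ; failed = false ; childIds = [] ; alarm = false ; height = 0
    }

  outputOf : NodeState → Output
  outputOf s = if alarm s then reject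
               else tree (if parentId s ≡ᵇ sentinel s then nothing else just (parentId s)) (childIds s) (height s)

  messageTo : NodeState → ℕ → Message
  messageTo s i = message (active s) (best s) (parentId s ≡ᵇ i) (alarm s) (height s)

  fields : Message → Vec ℕ 5
  fields m = bit (senderActive m) ∷ senderBest m ∷ bit (toParent m) ∷ bit (senderAlarm m) ∷ senderHeight m ∷ []

  fromFields : Vec ℕ 5 → Message
  fromFields (a ∷ b ∷ p ∷ r ∷ h ∷ []) = message (a ≡ᵇ 1) b (p ≡ᵇ 1) (r ≡ᵇ 1) h

  -- enough bits for N ^ (k + 1), which bounds every number that is sent
  width : ℕ → ℕ
  width N = suc k * suc ⌈log₂ N ⌉

  algorithm : Algorithm
  algorithm = record
    { State  = NodeState
    ; init   = initial
    ; send   = λ s i → encode (width (size s)) (fields (messageTo s i))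
    ; step   = λ s raw → step′ s (map (λ (i , bs) → i , fromFields (decode (width (size s)) 5 bs)) raw)
    ; output = outputOf
    }

module _ {X : Set} (f : X → ℕ × Message) where

  private
    msg : X → Message
    msg x = proj₂ (f x)

  minActive≤ : ∀ b xs → minActive b (map f xs) ≤ b
  minActive≤ b []       = ≤-refl
  minActive≤ b (x ∷ xs) with senderActive (msg x)
  ... | true  = ≤-trans (m⊓n≤n _ _) (minActive≤ b xs)
  ... | false = minActive≤ b xs

  minActive≤senderBest : ∀ b xs {x} → x ∈ xs → senderActive (msg x) ≡ true → minActive b (map f xs) ≤ senderBest (msg x)
  minActive≤senderBest b (x ∷ xs) (here refl) a rewrite a = m⊓n≤m _ _
  minActive≤senderBest b (y ∷ xs) (there x∈) a with senderActive (msg y)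
  ... | true  = ≤-trans (m⊓n≤n _ _) (minActive≤senderBest b xs x∈ a)
  ... | false = minActive≤senderBest b xs x∈ a

  minActive-attained : ∀ b xs → minActive b (map f xs) ≡ b
    ⊎ Σ X λ x → x ∈ xs × senderActive (msg x) ≡ true × minActive b (map f xs) ≡ senderBest (msg x)
  minActive-attained b [] = inj₁ refl
  minActive-attained b (x ∷ xs) with senderActive (msg x) in a | minActive-attained b xs
  ... | false | inj₁ e                = inj₁ e
  ... | false | inj₂ (y , y∈ , ay , e) = inj₂ (y , there y∈ , ay , e)
  ... | true  | rest with ⊓-sel (senderBest (msg x)) (minActive b (map f xs))
  ...   | inj₁ e = inj₂ (x , here refl , a , e)
  ...   | inj₂ e with rest
  ...     | inj₁ e′                = inj₁ (trans e e′)
  ...     | inj₂ (y , y∈ , ay , e′) = inj₂ (y , there y∈ , ay , trans e e′)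

  disagrees≡false⇒agree : ∀ b xs → disagrees b (map f xs) ≡ false →
                          ∀ {x} → x ∈ xs → senderActive (msg x) ≡ true → senderBest (msg x) ≡ b
  disagrees≡false⇒agree b (x ∷ xs) e (here refl) a
    with ∨-conicalˡ (senderActive (msg x) ∧ not (senderBest (msg x) ≡ᵇ b)) _ e
  ... | e₁ rewrite a with senderBest (msg x) ≡ᵇ b in eq
  ...   | true = ≡ᵇ≡true⇒≡ eq
  disagrees≡false⇒agree b (y ∷ xs) e (there x∈) a =
    disagrees≡false⇒agree b xs (∨-conicalʳ (senderActive (msg y) ∧ not (senderBest (msg y) ≡ᵇ b)) _ e) x∈ a

  agree⇒disagrees≡false : ∀ b xs → (∀ {x} → x ∈ xs → senderActive (msg x) ≡ true → senderBest (msg x) ≡ b) →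
                          disagrees b (map f xs) ≡ false
  agree⇒disagrees≡false b []       _     = refl
  agree⇒disagrees≡false b (x ∷ xs) agree with senderActive (msg x) in a
  ... | false = agree⇒disagrees≡false b xs (agree ∘ there)
  ... | true rewrite ≡⇒≡ᵇ≡true (agree (here refl) a) = agree⇒disagrees≡false b xs (agree ∘ there)

  anyAlarm≡true : ∀ xs {x} → x ∈ xs → senderAlarm (msg x) ≡ true → anyAlarm (map f xs) ≡ true
  anyAlarm≡true (x ∷ xs) (here refl) r rewrite r = refl
  anyAlarm≡true (y ∷ xs) (there x∈)  r = ∨-trueʳ (senderAlarm (msg y)) (anyAlarm≡true xs x∈ r)

  anyAlarm≡false : ∀ xs → (∀ {x} → x ∈ xs → senderAlarm (msg x) ≡ false) → anyAlarm (map f xs) ≡ false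
  anyAlarm≡false []       _    = refl
  anyAlarm≡false (x ∷ xs) none rewrite none (here refl) = anyAlarm≡false xs (none ∘ there)

  senderHeight≤maxHeight : ∀ xs {x} → x ∈ xs → senderHeight (msg x) ≤ maxHeight (map f xs)
  senderHeight≤maxHeight (x ∷ xs) (here refl) = m≤m⊔n _ _
  senderHeight≤maxHeight (y ∷ xs) (there x∈)  = ≤-trans (senderHeight≤maxHeight xs x∈) (m≤n⊔m _ _)

  maxHeight-attained : ∀ xs → maxHeight (map f xs) ≡ 0 ⊎ Σ X λ x → x ∈ xs × maxHeight (map f xs) ≡ senderHeight (msg x)
  maxHeight-attained [] = inj₁ refl
  maxHeight-attained (x ∷ xs) with ⊔-sel (senderHeight (msg x)) (maxHeight (map f xs))
  ... | inj₁ e = inj₂ (x , here refl , e)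
  ... | inj₂ e with maxHeight-attained xs
  ...   | inj₁ e′            = inj₁ (trans e e′)
  ...   | inj₂ (y , y∈ , e′) = inj₂ (y , there y∈ , trans e e′)

  childrenIn-sound : ∀ xs {i} → i ∈ childrenIn (map f xs) → Σ X λ x → x ∈ xs × proj₁ (f x) ≡ i × toParent (msg x) ≡ true
  childrenIn-sound (x ∷ xs) i∈ with toParent (msg x) in p
  childrenIn-sound (x ∷ xs) (here refl) | true = x , here refl , refl , p
  childrenIn-sound (x ∷ xs) (there i∈)  | true with childrenIn-sound xs i∈
  ... | y , y∈ , e , q = y , there y∈ , e , q
  childrenIn-sound (x ∷ xs) i∈ | false with childrenIn-sound xs i∈
  ... | y , y∈ , e , q = y , there y∈ , e , q

  childrenIn-complete : ∀ xs {x} → x ∈ xs → toParent (msg x) ≡ true → proj₁ (f x) ∈ childrenIn (map f xs)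
  childrenIn-complete (x ∷ xs) (here refl) p rewrite p = here refl
  childrenIn-complete (y ∷ xs) (there x∈)  p with toParent (msg y)
  ... | true  = there (childrenIn-complete xs x∈ p)
  ... | false = childrenIn-complete xs x∈ p

module Execution (k n : ℕ) (G : Graph (suc n)) (ids : Fin (suc n) → ℕ) (ids-injective : Injective _≡_ _≡_ ids)
                 (ids<∞ : ∀ v → ids v < suc n ^ k) (d : ℕ) where
  open Protocol k

  N : ℕ
  N = suc n

  -- opaque, so that goals about R t v do not unfold the whole execution
  opaque
    R : ℕ → Fin N → NodeState
    R t v = run algorithm G ids d t v

    R≡run : ∀ t v → R t v ≡ run algorithm G ids d t v
    R≡run t v = refl

    R-zero : ∀ v → R 0 v ≡ initial N d (ids v) (map ids (nbrs G v))
    R-zero v = refl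

    R-suc : ∀ t v → R (suc t) v ≡ step algorithm (R t v) (map (λ u → ids u , send algorithm (R t u) (ids v)) (nbrs G v))
    R-suc t v = refl

  ∞ : ℕ
  ∞ = N ^ k

  L : ℕ
  L = 2 ^ d

  W : ℕ
  W = width N

  truncate : ℕ → ℕ
  truncate x = fromBits (toBits W x)

  fits : ∀ {x} → x ≤ N ^ suc k → truncate x ≡ x
  fits {x} x≤ = fromBits-toBits W (begin-strict
    x                ≤⟨ x≤ ⟩
    N ^ suc k        ≤⟨ ^-monoˡ-≤ (suc k) (n≤2^⌈log₂n⌉ N) ⟩
    (2 ^ c) ^ suc k  ≡⟨ ^-*-assoc 2 c (suc k) ⟩
    2 ^ (c * suc k)  <⟨ ^-monoʳ-< 2 (s≤s (s≤s z≤n)) c*[1+k]<W ⟩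
    2 ^ W            ∎)
    where
    open ≤-Reasoning
    c = ⌈log₂ N ⌉
    c*[1+k]<W : c * suc k < W
    c*[1+k]<W = subst (c * suc k <_) (trans (cong (suc k +_) (*-comm c (suc k))) (sym (*-suc (suc k) c)))
                      (m<n+m (c * suc k) (s≤s z≤n))

  -- messages as decoded by the receiver: numbers are cut down to W bits
  received : NodeState → ℕ → Message
  received s i = message (active s) (truncate (best s)) (parentId s ≡ᵇ i) (alarm s) (truncate (height s))

  inbox : ℕ → Fin N → Inbox
  inbox t v = map (λ u → ids u , received (R t u) (ids v)) (nbrs G v)

  static : NodeState → ℕ × ℕ × ℕ × List ℕ
  static s = size s , depthBound s , myId s , nbrIds s

  static-R : ∀ t v → static (R t v) ≡ (N , d , ids v , map ids (nbrs G v))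
  static-R zero    v = cong static (R-zero v)
  static-R (suc t) v = trans (cong static (R-suc t v))
    (trans (atStage-elim (λ s → static s ≡ static (R t v)) (stage (R t v)) refl refl refl) (static-R t v))

  size-R : ∀ t v → size (R t v) ≡ N
  size-R t v = cong proj₁ (static-R t v)

  depthBound-R : ∀ t v → depthBound (R t v) ≡ d
  depthBound-R t v = cong (proj₁ ∘ proj₂) (static-R t v)

  myId-R : ∀ t v → myId (R t v) ≡ ids v
  myId-R t v = cong (proj₁ ∘ proj₂ ∘ proj₂) (static-R t v)

  nbrIds-R : ∀ t v → nbrIds (R t v) ≡ map ids (nbrs G v)
  nbrIds-R t v = cong (proj₂ ∘ proj₂ ∘ proj₂) (static-R t v)

  fromFields-fields : ∀ m → fromFields (Vec.map truncate (fields m))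
                          ≡ message (senderActive m) (truncate (senderBest m)) (toParent m) (senderAlarm m) (truncate (senderHeight m))
  fromFields-fields (message a b p r h) =
    cong₂ (λ a′ (p′ , r′) → message a′ (truncate b) p′ r′ (truncate h)) (bit-roundtrip a) (cong₂ _,_ (bit-roundtrip p) (bit-roundtrip r))
    where
    bit-roundtrip : ∀ x → (truncate (bit x) ≡ᵇ 1) ≡ x
    bit-roundtrip true  = cong (_≡ᵇ 1) (fits (m^n>0 N (suc k)))
    bit-roundtrip false = cong (_≡ᵇ 1) (fits z≤n)

  run-suc : ∀ t v → R (suc t) v ≡ step′ (R t v) (inbox t v)
  run-suc t v = trans (R-suc t v) (cong (step′ (R t v)) (trans (sym (map-∘ (nbrs G v))) (map-cong delivered (nbrs G v))))
    where
    delivered : ∀ u → (ids u , fromFields (decode (width (size (R t v))) 5 (encode (width (size (R t u))) (fields (messageTo (R t u) (ids v))))))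
                    ≡ (ids u , received (R t u) (ids v))
    delivered u = cong (ids u ,_) (begin
      fromFields (decode (width (size (R t v))) 5 (encode (width (size (R t u))) fs))
        ≡⟨ cong₂ (λ a b → fromFields (decode (width a) 5 (encode (width b) fs))) (size-R t v) (size-R t u) ⟩
      fromFields (decode W 5 (encode W fs))  ≡⟨ cong fromFields (decode-encode W fs) ⟩
      fromFields (Vec.map truncate fs)       ≡⟨ fromFields-fields (messageTo (R t u) (ids v)) ⟩
      received (R t u) (ids v)               ∎)
      where
      open ≡-Reasoning
      fs = fields (messageTo (R t u) (ids v))

  -- phase j < L starts at round T j and consists of L flooding rounds and one transition round
  T : ℕ → ℕ
  T zero    = 0
  T (suc j) = suc (T j + L)

  step-at : ∀ t v {g} → stage (R t v) ≡ g →
            R (suc t) v ≡ atStage g (floodStep (R t v) (inbox t v)) (transitionStep (R t v) (inbox t v)) (finalStep (R t v) (inbox t v))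
  step-at t v e = trans (run-suc t v) (cong (λ g → atStage g _ _ _) e)

  stage≡flooding : ∀ t v → phase (R t v) < L → tick (R t v) < L → stage (R t v) ≡ flooding
  stage≡flooding t v p<L s<L rewrite depthBound-R t v | <⇒<ᵇ≡true p<L | <⇒<ᵇ≡true s<L = refl

  stage≡transition : ∀ t v → phase (R t v) < L → tick (R t v) ≡ L → stage (R t v) ≡ transition
  stage≡transition t v p<L s≡L rewrite depthBound-R t v | <⇒<ᵇ≡true p<L | s≡L | ≤⇒<ᵇ≡false (≤-refl {L}) = refl

  stage≡final : ∀ t v → phase (R t v) ≡ L → stage (R t v) ≡ final
  stage≡final t v p≡L rewrite depthBound-R t v | p≡L | ≤⇒<ᵇ≡false (≤-refl {L}) = refl

  clock-start : ∀ j v → j ≤ L → phase (R (T j) v) ≡ j × tick (R (T j) v) ≡ 0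
  clock : ∀ j s v → j < L → s ≤ L → phase (R (T j + s) v) ≡ j × tick (R (T j + s) v) ≡ s
  clock-start zero    v _   = cong phase (R-zero v) , cong tick (R-zero v)
  clock-start (suc j) v j<L with clock j L v j<L ≤-refl
  ... | p≡j , s≡L = trans (cong phase next) (cong suc p≡j) , cong tick next
    where next = step-at (T j + L) v (stage≡transition (T j + L) v (subst (_< L) (sym p≡j) j<L) s≡L)
  clock j zero    v j<L _   = subst (λ t → phase (R t v) ≡ j × tick (R t v) ≡ 0) (sym (+-identityʳ (T j))) (clock-start j v (<⇒≤ j<L))
  clock j (suc s) v j<L s<L with clock j s v j<L (<⇒≤ s<L)
  ... | p≡j , s≡s = subst (λ t → phase (R t v) ≡ j × tick (R t v) ≡ suc s) (sym (+-suc (T j) s))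
                          (trans (cong phase next) p≡j , trans (cong tick next) (cong suc s≡s))
    where next = step-at (T j + s) v (stage≡flooding (T j + s) v (subst (_< L) (sym p≡j) j<L) (subst (_< L) (sym s≡s) s<L))

  flooding-round : ∀ j s v → j < L → s < L → R (T j + suc s) v ≡ floodStep (R (T j + s) v) (inbox (T j + s) v)
  flooding-round j s v j<L s<L with clock j s v j<L (<⇒≤ s<L)
  ... | p≡j , s≡s = trans (cong (λ t → R t v) (+-suc (T j) s))
                          (step-at (T j + s) v (stage≡flooding (T j + s) v (subst (_< L) (sym p≡j) j<L) (subst (_< L) (sym s≡s) s<L)))

  transition-round : ∀ j v → j < L → R (T (suc j)) v ≡ transitionStep (R (T j + L) v) (inbox (T j + L) v)
  transition-round j v j<L with clock j L v j<L ≤-refl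
  ... | p≡j , s≡L = step-at (T j + L) v (stage≡transition (T j + L) v (subst (_< L) (sym p≡j) j<L) s≡L)

  clock-final : ∀ r v → phase (R (T L + r) v) ≡ L
  final-round : ∀ r v → R (T L + suc r) v ≡ finalStep (R (T L + r) v) (inbox (T L + r) v)
  clock-final zero    v = trans (cong (λ t → phase (R t v)) (+-identityʳ (T L))) (proj₁ (clock-start L v ≤-refl))
  clock-final (suc r) v = trans (cong phase (final-round r v)) (clock-final r v)
  final-round r v = trans (cong (λ t → R t v) (+-suc (T L) r)) (step-at (T L + r) v (stage≡final (T L + r) v (clock-final r v)))

  flooding-preserves : {X : Set} (f : NodeState → X) → (∀ s ms → f (floodStep s ms) ≡ f s) →
                       ∀ j s v → j < L → s ≤ L → f (R (T j + s) v) ≡ f (R (T j) v)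
  flooding-preserves f pres j zero    v _   _   = cong (λ t → f (R t v)) (+-identityʳ (T j))
  flooding-preserves f pres j (suc s) v j<L s<L =
    trans (cong f (flooding-round j s v j<L s<L)) (trans (pres (R (T j + s) v) (inbox (T j + s) v)) (flooding-preserves f pres j s v j<L (<⇒≤ s<L)))

  final-preserves : {X : Set} (f : NodeState → X) → (∀ s ms → f (finalStep s ms) ≡ f s) →
                    ∀ r v → f (R (T L + r) v) ≡ f (R (T L) v)
  final-preserves f pres zero    v = cong (λ t → f (R t v)) (+-identityʳ (T L))
  final-preserves f pres (suc r) v = trans (cong f (final-round r v)) (trans (pres (R (T L + r) v) (inbox (T L + r) v)) (final-preserves f pres r v))

  best≤∞ : ∀ t v → best (R t v) ≤ ∞
  best≤∞ zero    v = ≤-trans (≤-reflexive (cong best (R-zero v))) (<⇒≤ (ids<∞ v))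
  best≤∞ (suc t) v = subst (_≤ ∞) (sym (cong best (run-suc t v)))
    (atStage-elim (λ s → best s ≤ ∞) (stage (R t v)) flooded own-or-none (best≤∞ t v))
    where
    s = R t v
    flooded : (if active s then minActive (best s) (inbox t v) else best s) ≤ ∞
    flooded with active s
    ... | true  = ≤-trans (minActive≤ _ (best s) (nbrs G v)) (best≤∞ t v)
    ... | false = best≤∞ t v
    own-or-none : ∀ {b} → (if b then myId s else sentinel s) ≤ ∞
    own-or-none {true}  = subst (_≤ ∞) (sym (myId-R t v)) (<⇒≤ (ids<∞ v))
    own-or-none {false} = ≤-reflexive (cong (_^ k) (size-R t v))

  N≤N^[1+k] : N ≤ N ^ suc k
  N≤N^[1+k] = m≤m*n N (N ^ k) {{m^n≢0 N k}}

  truncate-best : ∀ t v → truncate (best (R t v)) ≡ best (R t v)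
  truncate-best t v = fits (≤-trans (best≤∞ t v) (^-monoʳ-≤ N (n≤1+n k)))

  atPhase : ℕ → Fin N → NodeState
  atPhase j v = R (T j) v

  elected : ℕ → Fin N → ℕ
  elected j v = best (R (T j + L) v)

  Active : ℕ → Fin N → Set
  Active j v = active (atPhase j v) ≡ true

  Settled : ℕ → Fin N → Set
  Settled j v = active (atPhase j v) ≡ false

  module Transition (j : ℕ) (v : Fin N) (j<L : j < L) where
    private
      s : NodeState
      s = R (T j + L) v

      ms : Inbox
      ms = inbox (T j + L) v

      next : {X : Set} (f : NodeState → X) → f (atPhase (suc j) v) ≡ f (transitionStep s ms)
      next f = cong f (transition-round j v j<L)

      frozen : {X : Set} (f : NodeState → X) → (∀ s ms → f (floodStep s ms) ≡ f s) → f s ≡ f (atPhase j v)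
      frozen f pres = flooding-preserves f pres j L v j<L ≤-refl

      active≡ : active s ≡ active (atPhase j v)
      active≡ = frozen active (λ _ _ → refl)

      prevChosen≡ : prevChosen s ≡ prevChosen (atPhase j v)
      prevChosen≡ = frozen prevChosen (λ _ _ → refl)

      parentId≡ : parentId s ≡ parentId (atPhase j v)
      parentId≡ = frozen parentId (λ _ _ → refl)

      depth≡ : depth s ≡ depth (atPhase j v)
      depth≡ = frozen depth (λ _ _ → refl)

      failed≡ : failed s ≡ failed (atPhase j v)
      failed≡ = frozen failed (λ _ _ → refl)

    chosenIn : Bool
    chosenIn = active (atPhase j v) ∧ (elected j v ≡ᵇ ids v)

    active-next : active (atPhase (suc j) v) ≡ active (atPhase j v) ∧ not chosenIn
    active-next = trans (next active) substituted
      where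
      substituted : active s ∧ not (chosen s) ≡ active (atPhase j v) ∧ not chosenIn
      substituted rewrite active≡ | myId-R (T j + L) v = refl

    prevChosen-next : prevChosen (atPhase (suc j) v) ≡ (if active (atPhase j v) then elected j v else prevChosen (atPhase j v))
    prevChosen-next = trans (next prevChosen) substituted
      where
      substituted : (if active s then best s else prevChosen s) ≡ (if active (atPhase j v) then elected j v else prevChosen (atPhase j v))
      substituted rewrite active≡ | prevChosen≡ = refl

    parentId-next : parentId (atPhase (suc j) v) ≡ (if chosenIn then prevChosen (atPhase j v) else parentId (atPhase j v))
    parentId-next = trans (next parentId) substituted
      where
      substituted : (if chosen s then prevChosen s else parentId s) ≡ (if chosenIn then prevChosen (atPhase j v) else parentId (atPhase j v))
      substituted rewrite active≡ | prevChosen≡ | parentId≡ | myId-R (T j + L) v = refl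

    depth-next : depth (atPhase (suc j) v) ≡ (if chosenIn then suc j else depth (atPhase j v))
    depth-next = trans (next depth) substituted
      where
      substituted : (if chosen s then suc (phase s) else depth s) ≡ (if chosenIn then suc j else depth (atPhase j v))
      substituted rewrite active≡ | depth≡ | myId-R (T j + L) v | proj₁ (clock j L v j<L ≤-refl) = refl

    failed-next : failed (atPhase (suc j) v) ≡ failed (atPhase j v) ∨ (active (atPhase j v) ∧ ((elected j v ≡ᵇ ∞) ∨ disagrees (elected j v) ms))
    failed-next = trans (next failed) substituted
      where
      substituted : failed s ∨ (active s ∧ ((best s ≡ᵇ sentinel s) ∨ disagrees (best s) ms))
            ≡ failed (atPhase j v) ∨ (active (atPhase j v) ∧ ((elected j v ≡ᵇ ∞) ∨ disagrees (elected j v) ms))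
      substituted rewrite active≡ | failed≡ | size-R (T j + L) v = refl

    alarm-next : alarm (atPhase (suc j) v) ≡ failed (atPhase (suc j) v) ∨ active (atPhase (suc j) v)
    alarm-next = trans (next alarm) (sym (cong₂ _∨_ (next failed) (next active)))

    height-next : height (atPhase (suc j) v) ≡ depth (atPhase (suc j) v)
    height-next = trans (next height) (sym (next depth))

    best-next : best (atPhase (suc j) v) ≡ (if active (atPhase (suc j) v) ∧ candidate (atPhase (suc j) v) (prevChosen (atPhase (suc j) v)) then ids v else ∞)
    best-next = trans (next best) (trans substituted (sym (next (λ s′ → if active s′ ∧ candidate s′ (prevChosen s′) then ids v else ∞))))
      where
      substituted : best (transitionStep s ms) ≡ (if active (transitionStep s ms) ∧ candidate s (prevChosen (transitionStep s ms)) then ids v else ∞)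
      substituted rewrite myId-R (T j + L) v | size-R (T j + L) v = refl

    active-next⇒ : Active (suc j) v → Active j v × elected j v ≢ ids v
    active-next⇒ e with trans (sym active-next) e
    ... | e′ with active (atPhase j v)
    ...   | true  = refl , λ el≡id → true≢false (trans (sym e′) (cong not (≡⇒≡ᵇ≡true el≡id)))
    ...   | false = ⊥-elim (true≢false (sym e′))

    stays-active : Active j v → elected j v ≢ ids v → Active (suc j) v
    stays-active a el≢id = trans active-next (cong₂ (λ b c → b ∧ not (b ∧ c)) a (≢⇒≡ᵇ≡false el≢id))

    inactive-stays : Settled j v →
      Settled (suc j) v × parentId (atPhase (suc j) v) ≡ parentId (atPhase j v) × depth (atPhase (suc j) v) ≡ depth (atPhase j v)
    inactive-stays a = trans active-next (cong (λ b → b ∧ not (b ∧ (elected j v ≡ᵇ ids v))) a) ,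
                       trans parentId-next (if-false not-chosen) ,
                       trans depth-next (if-false not-chosen)
      where
      not-chosen : chosenIn ≡ false
      not-chosen = cong (_∧ (elected j v ≡ᵇ ids v)) a

    chosen-settles : Active j v → elected j v ≡ ids v →
      Settled (suc j) v × parentId (atPhase (suc j) v) ≡ prevChosen (atPhase j v) × depth (atPhase (suc j) v) ≡ suc j
    chosen-settles a el≡id = trans active-next (cong₂ (λ b c → b ∧ not c) a is-chosen) , trans parentId-next (if-true is-chosen) , trans depth-next (if-true is-chosen)
      where
      is-chosen : chosenIn ≡ true
      is-chosen = cong₂ _∧_ a (≡⇒≡ᵇ≡true el≡id)

    prevChosen-next-active : Active j v → prevChosen (atPhase (suc j) v) ≡ elected j v
    prevChosen-next-active a = trans prevChosen-next (if-true a)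

    Consistent : Set
    Consistent = Active j v → elected j v ≢ ∞ × disagrees (elected j v) ms ≡ false

    failed-next≡false⇒ : failed (atPhase (suc j) v) ≡ false → failed (atPhase j v) ≡ false × Consistent
    failed-next≡false⇒ e with trans (sym failed-next) e
    ... | e′ with failed (atPhase j v) | active (atPhase j v)
    ...   | false | false = refl , λ ()
    ...   | false | true  with elected j v ≡ᵇ ∞ in e₁ | disagrees (elected j v) ms
    ...     | false | false = refl , λ _ → (λ el≡∞ → true≢false (trans (sym (≡⇒≡ᵇ≡true el≡∞)) e₁)) , refl

    consistent⇒failed-next≡false : failed (atPhase j v) ≡ false → Consistent → failed (atPhase (suc j) v) ≡ false
    consistent⇒failed-next≡false f c rewrite failed-next | f with active (atPhase j v)
    ... | false = refl
    ... | true rewrite ≢⇒≡ᵇ≡false (proj₁ (c refl)) | proj₂ (c refl) = refl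

  ActiveEdge : ℕ → Fin N → Fin N → Set
  ActiveEdge j x y = Adj G x y × Active j x × Active j y

  IsCandidate : ℕ → Fin N → Set
  IsCandidate j x = prevChosen (atPhase j x) ≡ ∞ ⊎ prevChosen (atPhase j x) ∈ map ids (nbrs G x)

  candidate-sound : ∀ t x c → candidate (R t x) c ≡ true → c ≡ ∞ ⊎ c ∈ map ids (nbrs G x)
  candidate-sound t x c e with ∨≡true⇒ (c ≡ᵇ sentinel (R t x)) _ e
  ... | inj₁ c≡∞ = inj₁ (trans (≡ᵇ≡true⇒≡ c≡∞) (cong (_^ k) (size-R t x)))
  ... | inj₂ c∈  = inj₂ (subst (c ∈_) (nbrIds-R t x) (does≡true⇒ (c ∈? nbrIds (R t x)) c∈))

  candidate-complete : ∀ t x c → c ≡ ∞ ⊎ c ∈ map ids (nbrs G x) → candidate (R t x) c ≡ true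
  candidate-complete t x c (inj₁ c≡∞) = ∨-trueˡ _ (≡⇒≡ᵇ≡true (trans c≡∞ (sym (cong (_^ k) (size-R t x)))))
  candidate-complete t x c (inj₂ c∈)  = ∨-trueʳ _ (dec-true (c ∈? nbrIds (R t x)) (subst (c ∈_) (sym (nbrIds-R t x)) c∈))

  best-phase-start : ∀ j x → j ≤ L → best (atPhase j x) ≡ (if active (atPhase j x) ∧ candidate (atPhase j x) (prevChosen (atPhase j x)) then ids x else ∞)
  best-phase-start zero    x _   rewrite R-zero x | ≡⇒≡ᵇ≡true {N ^ k} refl = refl
  best-phase-start (suc j) x j<L = Transition.best-next j x j<L

  module Flooding (j : ℕ) (j<L : j < L) where

    active-during : ∀ s v → s ≤ L → active (R (T j + s) v) ≡ active (atPhase j v)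
    active-during s v = flooding-preserves active (λ _ _ → refl) j s v j<L

    best-during : ∀ s v → s < L →
      best (R (T j + suc s) v) ≡ (if active (R (T j + s) v) then minActive (best (R (T j + s) v)) (inbox (T j + s) v) else best (R (T j + s) v))
    best-during s v s<L = cong best (flooding-round j s v j<L s<L)

    best-initial : ∀ v → Active j v → IsCandidate j v → best (R (T j + 0) v) ≡ ids v
    best-initial v a c rewrite +-identityʳ (T j) | best-phase-start j v (<⇒≤ j<L) | a | candidate-complete (T j) v _ c = refl

    flood-bound : ∀ s → s ≤ L → ∀ {v x} → Active j v → Active j x → IsCandidate j x →
                  Reach (ActiveEdge j) s v x → best (R (T j + s) v) ≤ ids x
    flood-bound zero    _   av ax cx stay = ≤-reflexive (best-initial _ ax cx)
    flood-bound (suc s) s<L {v} {x} av ax cx r rewrite best-during s v s<L | active-during s v (<⇒≤ s<L) | av = via r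
      where
      via : Reach (ActiveEdge j) (suc s) v x → minActive (best (R (T j + s) v)) (inbox (T j + s) v) ≤ ids x
      via stay = ≤-trans (minActive≤ _ _ (nbrs G v)) (flood-bound s (<⇒≤ s<L) av ax cx stay)
      via (move {y = y} (y∈ , _ , ay) r′) =
        ≤-trans (minActive≤senderBest _ _ (nbrs G v) y∈ (trans (active-during s y (<⇒≤ s<L)) ay))
                (≤-trans (≤-reflexive (truncate-best (T j + s) y)) (flood-bound s (<⇒≤ s<L) ay ax cx r′))

    flood-source : ∀ s → s ≤ L → ∀ v → Active j v →
      best (R (T j + s) v) ≡ ∞ ⊎
      Σ (Fin N) λ y → Active j y × IsCandidate j y × Reach (ActiveEdge j) s v y × best (R (T j + s) v) ≡ ids y
    flood-source zero _ v av with active (atPhase j v) ∧ candidate (atPhase j v) (prevChosen (atPhase j v)) in ec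
    ... | true  = inj₂ (v , av , candidate-sound (T j) v _ (∧-conicalʳ _ _ ec) , stay ,
                        trans (cong (λ t → best (R t v)) (+-identityʳ (T j))) (trans (best-phase-start j v (<⇒≤ j<L)) (if-true ec)))
    ... | false = inj₁ (trans (cong (λ t → best (R t v)) (+-identityʳ (T j))) (trans (best-phase-start j v (<⇒≤ j<L)) (if-false ec)))
    flood-source (suc s) s<L v av rewrite best-during s v s<L | active-during s v (<⇒≤ s<L) | av
      with minActive-attained (λ u → ids u , received (R (T j + s) u) (ids v)) (best (R (T j + s) v)) (nbrs G v)
    ... | inj₁ e with flood-source s (<⇒≤ s<L) v av
    ...   | inj₁ e′                    = inj₁ (trans e e′)
    ...   | inj₂ (y , ay , cy , r , e′) = inj₂ (y , ay , cy , Reach-weaken (n≤1+n s) r , trans e e′)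
    flood-source (suc s) s<L v av | inj₂ (u , u∈ , au , e) with flood-source s (<⇒≤ s<L) u (trans (sym (active-during s u (<⇒≤ s<L))) au)
    ... | inj₁ e′ = inj₁ (trans e (trans (truncate-best (T j + s) u) e′))
    ... | inj₂ (y , ay , cy , r , e′) =
          inj₂ (y , ay , cy , move (u∈ , av , trans (sym (active-during s u (<⇒≤ s<L))) au) r ,
                trans e (trans (truncate-best (T j + s) u) e′))

  post : ℕ → Fin N → NodeState
  post r v = R (T L + r) v

  post-zero : ∀ v → post 0 v ≡ atPhase L v
  post-zero v = cong (λ t → R t v) (+-identityʳ (T L))

  alarm-post : ∀ r v → alarm (post (suc r) v) ≡ alarm (post r v) ∨ anyAlarm (inbox (T L + r) v)
  alarm-post r v = cong alarm (final-round r v)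

  height-post : ∀ r v → height (post (suc r) v) ≡ height (post r v) ⊔ maxHeight (inbox (T L + r) v)
  height-post r v = cong height (final-round r v)

  childIds-post : ∀ r v → childIds (post (suc r) v) ≡ childrenIn (inbox (T L + r) v)
  childIds-post r v = cong childIds (final-round r v)

  parentId-post : ∀ r v → parentId (post r v) ≡ parentId (atPhase L v)
  parentId-post = final-preserves parentId (λ _ _ → refl)

  alarm-spreads : ∀ r {v x} → Reach (Adj G) r v x → alarm (atPhase L x) ≡ true → alarm (post r v) ≡ true
  alarm-spreads zero    stay ax = trans (cong alarm (post-zero _)) ax
  alarm-spreads (suc r) {v} path ax rewrite alarm-post r v with path
  ... | stay              = ∨-trueˡ _ (alarm-spreads r stay ax)
  ... | move {y = y} y∈ p = ∨-trueʳ (alarm (post r v))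
                              (anyAlarm≡true (λ u → ids u , received (post r u) (ids v)) (nbrs G v) y∈ (alarm-spreads r p ax))

  no-alarm-post : (∀ x → alarm (atPhase L x) ≡ false) → ∀ r v → alarm (post r v) ≡ false
  no-alarm-post none zero    v = trans (cong alarm (post-zero v)) (none v)
  no-alarm-post none (suc r) v rewrite alarm-post r v | no-alarm-post none r v =
    anyAlarm≡false (λ u → ids u , received (post r u) (ids v)) (nbrs G v) (λ {u} _ → no-alarm-post none r u)

  module HeightFlooding (height≤N : ∀ x → height (atPhase L x) ≤ N) where

    height-attained : ∀ r v → Σ (Fin N) λ y → height (post r v) ≡ height (atPhase L y)
    truncate-height : ∀ r v → truncate (height (post r v)) ≡ height (post r v)
    height-attained zero    v = v , cong height (post-zero v)
    height-attained (suc r) v rewrite height-post r v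
      with ⊔-sel (height (post r v)) (maxHeight (inbox (T L + r) v))
         | maxHeight-attained (λ u → ids u , received (post r u) (ids v)) (nbrs G v)
    ... | inj₁ e | _       = proj₁ (height-attained r v) , trans e (proj₂ (height-attained r v))
    ... | inj₂ e | inj₁ e₀ = proj₁ (height-attained r v) ,
                             trans (trans (cong (height (post r v) ⊔_) e₀) (⊔-identityʳ _)) (proj₂ (height-attained r v))
    ... | inj₂ e | inj₂ (u , _ , e₁) = proj₁ (height-attained r u) , trans e (trans e₁ (trans (truncate-height r u) (proj₂ (height-attained r u))))
    truncate-height r v = fits (≤-trans (subst (_≤ N) (sym (proj₂ (height-attained r v))) (height≤N _)) N≤N^[1+k])

    height-spreads : ∀ r {v x} → Reach (Adj G) r v x → height (atPhase L x) ≤ height (post r v)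
    height-spreads zero    stay = ≤-reflexive (sym (cong height (post-zero _)))
    height-spreads (suc r) {v} path rewrite height-post r v with path
    ... | stay              = ≤-trans (height-spreads r stay) (m≤m⊔n _ _)
    ... | move {y = y} y∈ p = begin
      height (atPhase L _)    ≤⟨ height-spreads r p ⟩
      height (post r y)     ≡⟨ truncate-height r y ⟨
      truncate (height (post r y)) ≤⟨ senderHeight≤maxHeight (λ u → ids u , received (post r u) (ids v)) (nbrs G v) y∈ ⟩
      maxHeight (inbox (T L + r) v) ≤⟨ m≤n⊔m _ _ ⟩
      height (post r v) ⊔ maxHeight (inbox (T L + r) v) ∎
      where open ≤-Reasoning

  children-sound : ∀ r v {i} → i ∈ childIds (post (suc r) v) → Σ (Fin N) λ u → u ∈ nbrs G v × ids u ≡ i × parentId (atPhase L u) ≡ ids v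
  children-sound r v {i} i∈ rewrite childIds-post r v with childrenIn-sound (λ u → ids u , received (post r u) (ids v)) (nbrs G v) i∈
  ... | u , u∈ , e , p = u , u∈ , e , trans (sym (parentId-post r u)) (≡ᵇ≡true⇒≡ p)

  children-complete : ∀ r v {u} → u ∈ nbrs G v → parentId (atPhase L u) ≡ ids v → ids u ∈ childIds (post (suc r) v)
  children-complete r v {u} u∈ p rewrite childIds-post r v =
    childrenIn-complete (λ u → ids u , received (post r u) (ids v)) (nbrs G v) u∈ (≡⇒≡ᵇ≡true (trans (parentId-post r u) p))

  -- The tree grown by consistent phases

  ids≢∞ : ∀ u → ids u ≢ ∞
  ids≢∞ u e = <-irrefl e (ids<∞ u)

  AllConsistent : (j : ℕ) → j < L → Set
  AllConsistent j j<L = ∀ v → Transition.Consistent j v j<L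

  module Agreement (j : ℕ) (j<L : j < L) (consistent : AllConsistent j j<L) where
    open Flooding j j<L

    neighbours-agree : ∀ {v u} → Active j v → Active j u → u ∈ nbrs G v → elected j u ≡ elected j v
    neighbours-agree {v} {u} av au u∈ =
      trans (sym (truncate-best (T j + L) u))
        (disagrees≡false⇒agree (λ u → ids u , received (R (T j + L) u) (ids v)) (elected j v) (nbrs G v)
          (proj₂ (consistent v av)) u∈ (trans (active-during L u ≤-refl) au))

    elected-along : ∀ {s v w} → Active j v → Reach (ActiveEdge j) s v w → elected j v ≡ elected j w
    elected-along av stay                  = refl
    elected-along av (move (u∈ , _ , au) r) = trans (sym (neighbours-agree av au u∈)) (elected-along au r)

    elected-source : ∀ v → Active j v → Σ (Fin N) λ y → Active j y × IsCandidate j y × Reach (ActiveEdge j) L v y × elected j v ≡ ids y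
    elected-source v av with flood-source L ≤-refl v av
    ... | inj₁ el≡∞ = ⊥-elim (proj₁ (consistent v av) el≡∞)
    ... | inj₂ src  = src

  findId : List (Fin N) → ℕ → Maybe (Fin N)
  findId us i = find (λ u → ids u ≟ i) us

  findId-complete : ∀ us {u i} → u ∈ us → ids u ≡ i → findId us i ≡ just u
  findId-complete (u′ ∷ us) {u} {i} u∈ e with ids u′ ≡ᵇ i in eq
  ... | true = cong just (ids-injective (trans (≡ᵇ≡true⇒≡ eq) (sym e)))
  findId-complete (u′ ∷ us) (here refl) e | false = ⊥-elim (true≢false (trans (sym (≡⇒≡ᵇ≡true e)) eq))
  findId-complete (u′ ∷ us) (there u∈)  e | false = findId-complete us u∈ e

  findId-sound : ∀ us {u i} → findId us i ≡ just u → u ∈ us × ids u ≡ i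
  findId-sound (u′ ∷ us) {u} {i} e with ids u′ ≡ᵇ i in eq
  findId-sound (u′ ∷ us) refl | true = here refl , ≡ᵇ≡true⇒≡ eq
  ... | false with findId-sound us e
  ...   | u∈ , e′ = there u∈ , e′

  findId-none : ∀ us {i} → (∀ {u} → u ∈ us → ids u ≢ i) → findId us i ≡ nothing
  findId-none []        _    = refl
  findId-none (u′ ∷ us) none rewrite ≢⇒≡ᵇ≡false (none (here refl)) = findId-none us (none ∘ there)

  parent : Fin N → Maybe (Fin N)
  parent v = findId (nbrs G v) (parentId (atPhase L v))

  settled-frozen : ∀ e j v → j + e ≤ L → Settled j v →
    Settled (j + e) v × parentId (atPhase (j + e) v) ≡ parentId (atPhase j v) × depth (atPhase (j + e) v) ≡ depth (atPhase j v)
  settled-frozen zero    j v _   sv rewrite +-identityʳ j = sv , refl , refl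
  settled-frozen (suc e) j v j+e<L sv rewrite +-suc j e with settled-frozen e j v (≤-trans (n≤1+n _) j+e<L) sv
  ... | s′ , p′ , d′ with Transition.inactive-stays (j + e) v j+e<L s′
  ...   | s″ , p″ , d″ = s″ , trans p″ p′ , trans d″ d′

  settled-final : ∀ j v → j ≤ L → Settled j v →
    Settled L v × parentId (atPhase L v) ≡ parentId (atPhase j v) × depth (atPhase L v) ≡ depth (atPhase j v)
  settled-final j v j≤L sv =
    subst (λ t → Settled t v × parentId (atPhase t v) ≡ parentId (atPhase j v) × depth (atPhase t v) ≡ depth (atPhase j v))
          (m+[n∸m]≡n j≤L) (settled-frozen (L ∸ j) j v (≤-reflexive (m+[n∸m]≡n j≤L)) sv)

  PrevChosen : ℕ → Fin N → Set
  PrevChosen zero    v = prevChosen (atPhase 0 v) ≡ ∞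
  PrevChosen (suc j) v = Σ (Fin N) λ u → ids u ≡ prevChosen (atPhase (suc j) v) × Settled (suc j) u × depth (atPhase (suc j) u) ≡ suc j

  PrevChosen-view : ∀ j y → PrevChosen j y → (j ≡ 0 × prevChosen (atPhase j y) ≡ ∞) ⊎
    Σ (Fin N) λ u → ids u ≡ prevChosen (atPhase j y) × Settled j u × depth (atPhase j u) ≡ j
  PrevChosen-view zero    y p = inj₁ (refl , p)
  PrevChosen-view (suc j) y p = inj₂ p

  ParentLink : ℕ → Fin N → Set
  ParentLink j v = (parentId (atPhase j v) ≡ ∞ × depth (atPhase j v) ≡ 1) ⊎
    Σ (Fin N) λ u → u ∈ nbrs G v × ids u ≡ parentId (atPhase j v) × Settled j u × suc (depth (atPhase j u)) ≡ depth (atPhase j v)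

  record Invariant (j : ℕ) : Set where
    field
      settled-link     : ∀ v → Settled j v → 1 ≤ depth (atPhase j v) × depth (atPhase j v) ≤ j × ParentLink j v
      active-prev      : ∀ v → Active j v → PrevChosen j v
      prev-agree       : ∀ u w → Active j u → Active j w → w ∈ nbrs G u → prevChosen (atPhase j u) ≡ prevChosen (atPhase j w)
      settled-vertical : ∀ u v → u ∈ nbrs G v → Settled j u →
                         (Active j v → ∀ a → ids a ≡ prevChosen (atPhase j v) → Anc parent u a) ×
                         (Settled j v → Anc parent u v ⊎ Anc parent v u)
      root-elected     : ∀ v → Settled j v → parentId (atPhase j v) ≡ ∞ → elected 0 v ≡ ids v

  active-zero : ∀ v → Active 0 v
  active-zero v = cong active (R-zero v)

  ¬settled-zero : ∀ {v} → ¬ Settled 0 v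
  ¬settled-zero {v} s = true≢false (trans (sym (active-zero v)) s)

  invariant-zero : Invariant 0
  invariant-zero = record
    { settled-link     = λ v s → ⊥-elim (¬settled-zero s)
    ; active-prev      = λ v _ → cong prevChosen (R-zero v)
    ; prev-agree       = λ u w _ _ _ → trans (cong prevChosen (R-zero u)) (sym (cong prevChosen (R-zero w)))
    ; settled-vertical = λ u v _ s → ⊥-elim (¬settled-zero s)
    ; root-elected     = λ v s → ⊥-elim (¬settled-zero s)
    }

  prevChosen-along : ∀ j (inv : Invariant j) {s v w} → Active j v → Reach (ActiveEdge j) s v w →
                     prevChosen (atPhase j v) ≡ prevChosen (atPhase j w)
  prevChosen-along j inv av stay                             = refl
  prevChosen-along j inv av (move {y = y} (y∈ , _ , ay) r) = trans (Invariant.prev-agree inv _ y av ay y∈) (prevChosen-along j inv ay r)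

  module InvariantStep (j : ℕ) (j<L : j < L) (consistent : AllConsistent j j<L) (inv : Invariant j) where
    open Invariant inv
    open Agreement j j<L consistent
    open Transition j

    elected-self⇒candidate : ∀ y → Active j y → elected j y ≡ ids y → IsCandidate j y
    elected-self⇒candidate y ay e with elected-source y ay
    ... | y′ , _ , c , _ , e′ with ids-injective (trans (sym e′) e)
    ...   | refl = c

    chosen-parent : ∀ y → Active j y → elected j y ≡ ids y →
      (j ≡ 0 × prevChosen (atPhase j y) ≡ ∞) ⊎
      Σ (Fin N) λ u → u ∈ nbrs G y × ids u ≡ prevChosen (atPhase j y) × Settled j u × depth (atPhase j u) ≡ j
    chosen-parent y ay e with PrevChosen-view j y (active-prev y ay) | elected-self⇒candidate y ay e
    ... | inj₁ p                    | _        = inj₁ p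
    ... | inj₂ (u , eu , su , du) | inj₁ p≡∞ = ⊥-elim (ids≢∞ u (trans eu p≡∞))
    ... | inj₂ (u , eu , su , du) | inj₂ p∈ with ∈-map⁻ ids p∈
    ...   | u′ , u′∈ , e′ with ids-injective (trans eu e′)
    ...     | refl = inj₂ (u , u′∈ , eu , su , du)

    chosen-settled : ∀ y → Active j y → elected j y ≡ ids y → Settled (suc j) y
    chosen-settled y ay e = proj₁ (chosen-settles y j<L ay e)

    chosen-parent-pointer : ∀ y u → Active j y → elected j y ≡ ids y → u ∈ nbrs G y → ids u ≡ prevChosen (atPhase j y) → parent y ≡ just u
    chosen-parent-pointer y u ay e u∈ eu = findId-complete (nbrs G y) u∈
      (trans eu (sym (trans (proj₁ (proj₂ (settled-final (suc j) y j<L (chosen-settled y ay e))))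
                            (proj₁ (proj₂ (chosen-settles y j<L ay e))))))

    newly-settled⇒chosen : ∀ v → Active j v → Settled (suc j) v → elected j v ≡ ids v
    newly-settled⇒chosen v av sv with elected j v ≟ ids v
    ... | yes e = e
    ... | no ne = ⊥-elim (true≢false (trans (sym (stays-active v j<L av ne)) sv))

    parent-of-chosen : ∀ y x → Active j y → elected j y ≡ ids y → Settled j x →
      Σ (Fin N) λ u → u ∈ nbrs G y × ids u ≡ prevChosen (atPhase j y) × parent y ≡ just u
    parent-of-chosen y x ay e sx with chosen-parent y ay e
    ... | inj₁ (refl , _)             = ⊥-elim (¬settled-zero sx)
    ... | inj₂ (u , u∈ , eu , _ , _) = u , u∈ , eu , chosen-parent-pointer y u ay e u∈ eu

    settled-link′ : ∀ v → Settled (suc j) v → 1 ≤ depth (atPhase (suc j) v) × depth (atPhase (suc j) v) ≤ suc j × ParentLink (suc j) v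
    settled-link′ v sv with Bool-dichotomy (active (atPhase j v))
    ... | inj₂ svj with inactive-stays v j<L svj | settled-link v svj
    ...   | _ , ep , ed | 1≤d , d≤j , inj₁ (p≡∞ , d≡1) =
            subst (1 ≤_) (sym ed) 1≤d , subst (_≤ suc j) (sym ed) (m≤n⇒m≤1+n d≤j) , inj₁ (trans ep p≡∞ , trans ed d≡1)
    ...   | _ , ep , ed | 1≤d , d≤j , inj₂ (u , u∈ , eu , su , du) with inactive-stays u j<L su
    ...     | su′ , _ , edu =
            subst (1 ≤_) (sym ed) 1≤d , subst (_≤ suc j) (sym ed) (m≤n⇒m≤1+n d≤j) ,
            inj₂ (u , u∈ , trans eu (sym ep) , su′ , trans (cong suc edu) (trans du (sym ed)))
    settled-link′ v sv | inj₁ avj with newly-settled⇒chosen v avj sv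
    ... | e with chosen-settles v j<L avj e | chosen-parent v avj e
    ...   | _ , ep , ed | inj₁ (refl , p≡∞) =
            subst (1 ≤_) (sym ed) (s≤s z≤n) , ≤-reflexive ed , inj₁ (trans ep p≡∞ , ed)
    ...   | _ , ep , ed | inj₂ (u , u∈ , eu , su , du) with inactive-stays u j<L su
    ...     | su′ , _ , edu =
            subst (1 ≤_) (sym ed) (s≤s z≤n) , ≤-reflexive ed ,
            inj₂ (u , u∈ , trans eu (sym ep) , su′ , trans (cong suc (trans edu du)) (sym ed))

    active-prev′ : ∀ v → Active (suc j) v → PrevChosen (suc j) v
    active-prev′ v av′ with active-next⇒ v j<L av′
    ... | avj , _ with elected-source v avj
    ...   | y , ay , _ , r , e =
            y , trans (sym e) (sym (prevChosen-next-active v j<L avj)) , chosen-settled y ay ey , proj₂ (proj₂ (chosen-settles y j<L ay ey))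
      where
      ey : elected j y ≡ ids y
      ey = trans (sym (elected-along avj r)) e

    prev-agree′ : ∀ u w → Active (suc j) u → Active (suc j) w → w ∈ nbrs G u → prevChosen (atPhase (suc j) u) ≡ prevChosen (atPhase (suc j) w)
    prev-agree′ u w au aw w∈ with active-next⇒ u j<L au | active-next⇒ w j<L aw
    ... | auj , _ | awj , _ rewrite prevChosen-next-active u j<L auj | prevChosen-next-active w j<L awj = sym (neighbours-agree auj awj w∈)

    settled-vertical′ : ∀ u v → u ∈ nbrs G v → Settled (suc j) u →
                        (Active (suc j) v → ∀ a → ids a ≡ prevChosen (atPhase (suc j) v) → Anc parent u a) ×
                        (Settled (suc j) v → Anc parent u v ⊎ Anc parent v u)
    settled-vertical′ u v u∈ su = towards-active , between-settled
      where
      towards-active : Active (suc j) v → ∀ a → ids a ≡ prevChosen (atPhase (suc j) v) → Anc parent u a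
      towards-active av a ea with active-next⇒ v j<L av
      ... | avj , _ with elected-source v avj
      ...   | y , ay , _ , r , e with ids-injective (trans ea (trans (prevChosen-next-active v j<L avj) e))
      ...     | refl with Bool-dichotomy (active (atPhase j u))
      ...       | inj₂ suj with parent-of-chosen a u ay (trans (sym (elected-along avj r)) e) suj
      ...         | u′ , _ , eu′ , pe = there pe (proj₁ (settled-vertical u v u∈ suj) avj u′ (trans eu′ (sym (prevChosen-along j inv avj r))))
      towards-active av a ea | avj , _ | y , ay , _ , r , e | refl | inj₁ auj
        with ids-injective (trans (sym e) (trans (sym (neighbours-agree avj auj u∈)) (newly-settled⇒chosen u auj su)))
      ...         | refl = here
      between-settled : Settled (suc j) v → Anc parent u v ⊎ Anc parent v u
      between-settled sv with Bool-dichotomy (active (atPhase j u)) | Bool-dichotomy (active (atPhase j v))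
      ... | inj₂ suj | inj₂ svj = proj₂ (settled-vertical u v u∈ suj) svj
      ... | inj₂ suj | inj₁ avj with parent-of-chosen v u avj (newly-settled⇒chosen v avj sv) suj
      ...   | u′ , _ , eu′ , pe = inj₁ (there pe (proj₁ (settled-vertical u v u∈ suj) avj u′ eu′))
      between-settled sv | inj₁ auj | inj₂ svj with parent-of-chosen u v auj (newly-settled⇒chosen u auj su) svj
      ...   | u′ , _ , eu′ , pe = inj₂ (there pe (proj₁ (settled-vertical v u (Graph.sym G u v u∈) svj) auj u′ eu′))
      between-settled sv | inj₁ auj | inj₁ avj
        with ids-injective (trans (sym (newly-settled⇒chosen u auj su)) (trans (neighbours-agree avj auj u∈) (newly-settled⇒chosen v avj sv)))
      ...   | refl = inj₁ here

    root-elected′ : ∀ v → Settled (suc j) v → parentId (atPhase (suc j) v) ≡ ∞ → elected 0 v ≡ ids v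
    root-elected′ v sv p≡∞ with Bool-dichotomy (active (atPhase j v))
    ... | inj₂ svj = root-elected v svj (trans (sym (proj₁ (proj₂ (inactive-stays v j<L svj)))) p≡∞)
    ... | inj₁ avj with chosen-parent v avj (newly-settled⇒chosen v avj sv)
    ...   | inj₁ (refl , _)          = newly-settled⇒chosen v avj sv
    ...   | inj₂ (u , _ , eu , _ , _) =
            ⊥-elim (ids≢∞ u (trans eu (trans (sym (proj₁ (proj₂ (chosen-settles v j<L avj (newly-settled⇒chosen v avj sv))))) p≡∞)))

    invariant-suc : Invariant (suc j)
    invariant-suc = record
      { settled-link = settled-link′ ; active-prev = active-prev′ ; prev-agree = prev-agree′
      ; settled-vertical = settled-vertical′ ; root-elected = root-elected′ }

  settled-chain : ∀ j (inv : Invariant j) m a → Settled j a → depth (atPhase j a) ≡ m →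
    Σ (List (Fin N)) λ xs → length (a ∷ xs) ≡ m × Unique (a ∷ xs) × Linked (Adj G) (a ∷ xs) ×
      All (λ x → Settled j x × depth (atPhase j x) ≤ m) (a ∷ xs)
  settled-chain j inv zero    a sa da = ⊥-elim (1+n≰n (≤-trans (proj₁ (Invariant.settled-link inv a sa)) (≤-reflexive da)))
  settled-chain j inv (suc m) a sa da with Invariant.settled-link inv a sa
  ... | _ , _ , inj₁ (_ , d≡1) = [] , trans (sym d≡1) da , [] ∷ [] , [-] , (sa , ≤-reflexive da) ∷ []
  ... | _ , _ , inj₂ (u , u∈ , _ , su , du) with settled-chain j inv m u su (suc-injective (trans du da))
  ...   | xs , len , uniq , linked , below =
          u ∷ xs , cong suc len , a∉ ∷ uniq , u∈ ∷ linked , (sa , ≤-reflexive da) ∷ All.map (Product.map₂ (m≤n⇒m≤1+n)) below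
    where
    a∉ : All (a ≢_) (u ∷ xs)
    a∉ = All.map (λ { {x} (_ , dx≤m) refl → 1+n≰n (≤-trans (≤-reflexive (sym da)) dx≤m) }) below

  L′ : ℕ
  L′ = pred L

  1+L′≡L : suc L′ ≡ L
  1+L′≡L = suc-pred L {{m^n≢0 2 d}}

  L′<L : L′ < L
  L′<L = ≤-reflexive 1+L′≡L

  alarm-final : ∀ v → alarm (atPhase L v) ≡ failed (atPhase L v) ∨ active (atPhase L v)
  alarm-final v = subst (λ t → alarm (atPhase t v) ≡ failed (atPhase t v) ∨ active (atPhase t v)) 1+L′≡L
                        (Transition.alarm-next L′ v L′<L)

  height-final : ∀ v → height (atPhase L v) ≡ depth (atPhase L v)
  height-final v = subst (λ t → height (atPhase t v) ≡ depth (atPhase t v)) 1+L′≡L (Transition.height-next L′ v L′<L)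

  no-failure-before : ∀ e j v → j + e ≤ L → failed (atPhase (j + e) v) ≡ false → failed (atPhase j v) ≡ false
  no-failure-before zero    j v _     f = subst (λ t → failed (atPhase t v) ≡ false) (+-identityʳ j) f
  no-failure-before (suc e) j v j+e<L f = no-failure-before e j v (<⇒≤ j+e<L′)
    (proj₁ (Transition.failed-next≡false⇒ (j + e) v j+e<L′ (subst (λ t → failed (atPhase t v) ≡ false) (+-suc j e) f)))
    where
    j+e<L′ : j + e < L
    j+e<L′ = subst (_≤ L) (+-suc j e) j+e<L

  -- guarantees that the next election in the component of an active vertex has a candidate
  Frontier : ℕ → Fin N → Set
  Frontier zero    v = ⊤
  Frontier (suc j) v = Σ (Fin N) λ w → Σ (Fin N) λ a → ids a ≡ prevChosen (atPhase (suc j) v) ×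
                       (Σ ℕ λ s → Reach (ActiveEdge (suc j)) s v w) × Active (suc j) w × w ∈ nbrs G a

  record PhaseInvariant (j : ℕ) : Set where
    field
      invariant  : Invariant j
      no-failure : ∀ v → failed (atPhase j v) ≡ false
      frontier   : ∀ v → Active j v → Frontier j v

  phaseInvariant-zero : PhaseInvariant 0
  phaseInvariant-zero = record { invariant = invariant-zero ; no-failure = λ v → cong failed (R-zero v) ; frontier = λ v _ → tt }

  -- Graphs of treedepth at most d

  module Shallow (q : Fin N → Maybe (Fin N)) (elim : IsElimForest G q) (depth≤d : DepthAtMost q d) where
    open Forest q
    open DepthBound d depth≤d (proj₁ elim)

    path-length<L : ∀ xs → Unique xs → Linked (Adj G) xs → length xs < L
    path-length<L xs u lk = chain-length<2^d xs u (Linked.map (λ {x} {y} → proj₂ elim x y) lk)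

    shortcut : ∀ j {s x y} → Reach (ActiveEdge j) s x y → Reach (ActiveEdge j) L x y
    shortcut j r with Reach⇒simplePath r
    ... | xs , p , u = Path⇒Reach p (≤-trans (<⇒≤ (path-length<L xs u (Linked.map proj₁ (Path⇒Linked p)))) (n≤1+n L))

    candidate-nearby : ∀ j → PhaseInvariant j → ∀ v → Active j v →
                       Σ (Fin N) λ c → Active j c × IsCandidate j c × Reach (ActiveEdge j) L v c
    candidate-nearby zero    _    v av = v , av , inj₁ (cong prevChosen (R-zero v)) , stay
    candidate-nearby (suc j) pinv v av with PhaseInvariant.frontier pinv v av
    ... | w , a , ea , (s , r) , aw , w∈ =
          w , aw ,
          inj₂ (subst (_∈ map ids (nbrs G w)) (trans ea (prevChosen-along (suc j) (PhaseInvariant.invariant pinv) av r))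
                      (∈-map⁺ ids (Graph.sym G w a w∈))) ,
          shortcut (suc j) r

    -- an active vertex together with the chain of vertices chosen before it forms a simple path of j + 2 vertices
    active⇒2+j<L : ∀ j → PhaseInvariant (suc j) → ∀ v → Active (suc j) v → suc (suc j) < L
    active⇒2+j<L j pinv v av with PhaseInvariant.frontier pinv v av
    ... | w , a , ea , _ , aw , w∈ with PrevChosen-view (suc j) v (Invariant.active-prev inv v av)
      where inv = PhaseInvariant.invariant pinv
    ...   | inj₁ (() , _)
    ...   | inj₂ (u , eu , su , du) with ids-injective (trans ea (sym eu))
    ...     | refl with settled-chain (suc j) (PhaseInvariant.invariant pinv) (suc j) a su du
    ...       | xs , len , uniq , linked , below =
                subst (_< L) (cong suc len) (path-length<L (w ∷ a ∷ xs) (w∉ ∷ uniq) (Graph.sym G w a w∈ ∷ linked))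
      where
      w∉ : All (w ≢_) (a ∷ xs)
      w∉ = All.map (λ { (sx , _) refl → true≢false (trans (sym aw) sx) }) below

    module Consistency (j : ℕ) (j<L : j < L) (pinv : PhaseInvariant j) where
      open Flooding j j<L

      elected≢∞ : ∀ v → Active j v → elected j v ≢ ∞
      elected≢∞ v av el≡∞ with candidate-nearby j pinv v av
      ... | c , ac , cc , rc = <-irrefl refl (≤-<-trans (≤-trans (≤-reflexive (sym el≡∞)) (flood-bound L ≤-refl av ac cc rc)) (ids<∞ c))

      elected≤neighbour : ∀ v x → Active j v → Active j x → x ∈ nbrs G v → elected j v ≤ elected j x
      elected≤neighbour v x av ax x∈ with flood-source L ≤-refl x ax
      ... | inj₁ el≡∞ = ⊥-elim (elected≢∞ x ax el≡∞)
      ... | inj₂ (y , ay , cy , r , e) = ≤-trans (flood-bound L ≤-refl av ay cy (shortcut j (move (x∈ , av , ax) r))) (≤-reflexive (sym e))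

      all-consistent : AllConsistent j j<L
      all-consistent v av = elected≢∞ v av ,
        agree⇒disagrees≡false (λ u → ids u , received (R (T j + L) u) (ids v)) (elected j v) (nbrs G v)
          (λ {x} x∈ ax → let ax′ = trans (sym (active-during L x ≤-refl)) ax in
             trans (truncate-best (T j + L) x) (≤-antisym (elected≤neighbour x v ax′ av (Graph.sym G x v x∈)) (elected≤neighbour v x av ax′ x∈)))

    module Advance (j : ℕ) (j<L : j < L) (pinv : PhaseInvariant j) where
      open Consistency j j<L pinv
      open Agreement j j<L all-consistent

      -- w is the last vertex before y on the active path from x to y
      frontier-along : ∀ {s x y} → Reach (ActiveEdge j) s x y → Active (suc j) x → elected j x ≡ ids y →
        Σ (Fin N) λ w → (Σ ℕ λ s′ → Reach (ActiveEdge (suc j)) s′ x w) × Active (suc j) w × w ∈ nbrs G y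
      frontier-along stay ax e = ⊥-elim (proj₂ (Transition.active-next⇒ j _ j<L ax) e)
      frontier-along {x = x} {y = y} (move {y = x′} (x′∈ , axj , ax′j) r) ax e with x′ ≟ᶠ y
      ... | yes refl = x , (0 , stay) , ax , Graph.sym G x′ x x′∈
      ... | no x′≢y = let w , (s′ , r′) , aw , w∈ = frontier-along r ax′ e′ in w , (suc s′ , move (x′∈ , ax , ax′) r′) , aw , w∈
        where
        e′ : elected j x′ ≡ ids y
        e′ = trans (neighbours-agree axj ax′j x′∈) e
        ax′ : Active (suc j) x′
        ax′ = Transition.stays-active j x′ j<L ax′j (λ e″ → x′≢y (ids-injective (trans (sym e″) e′)))

      frontier′ : ∀ v → Active (suc j) v → Frontier (suc j) v
      frontier′ v av′ with Transition.active-next⇒ j v j<L av′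
      ... | avj , _ with elected-source v avj
      ...   | y , _ , _ , r , e with frontier-along r av′ e
      ...     | w , rw , aw , w∈ = w , y , trans (sym e) (sym (Transition.prevChosen-next-active j v j<L avj)) , rw , aw , w∈

      phaseInvariant-suc : PhaseInvariant (suc j)
      phaseInvariant-suc = record
        { invariant  = InvariantStep.invariant-suc j j<L all-consistent (PhaseInvariant.invariant pinv)
        ; no-failure = λ v → Transition.consistent⇒failed-next≡false j v j<L (PhaseInvariant.no-failure pinv v) (all-consistent v)
        ; frontier   = frontier′
        }

    phaseInvariant : ∀ j → j ≤ L → PhaseInvariant j
    phaseInvariant zero    _   = phaseInvariant-zero
    phaseInvariant (suc j) j<L = Advance.phaseInvariant-suc j j<L (phaseInvariant j (<⇒≤ j<L))

    settles-within-L : ∀ v → Settled L v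
    settles-within-L v with Bool-dichotomy (active (atPhase L v))
    ... | inj₂ s = s
    ... | inj₁ a = ⊥-elim (<-irrefl refl (≤-trans (n≤1+n _) (subst (λ t → suc t < L) 1+L′≡L
          (active⇒2+j<L L′ (subst PhaseInvariant (sym 1+L′≡L) (phaseInvariant L ≤-refl)) v (subst (λ t → Active t v) (sym 1+L′≡L) a)))))

    no-alarm : ∀ v → alarm (atPhase L v) ≡ false
    no-alarm v rewrite alarm-final v | PhaseInvariant.no-failure (phaseInvariant L ≤-refl) v | settles-within-L v = refl

  rounds : ℕ
  rounds = 4 * 2 ^ (2 * d)

  T≡j*[1+L] : ∀ j → T j ≡ j * suc L
  T≡j*[1+L] zero    = refl
  T≡j*[1+L] (suc j) = cong suc (trans (cong (_+ L) (T≡j*[1+L] j)) (+-comm (j * suc L) L))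

  schedule-fits : T L + (L + L) ≤ rounds
  schedule-fits = begin
    T L + (L + L)               ≡⟨ cong (_+ (L + L)) (trans (T≡j*[1+L] L) (*-suc L L)) ⟩
    L + L * L + (L + L)         ≤⟨ +-mono-≤ (+-monoˡ-≤ (L * L) L≤L*L) (+-mono-≤ L≤L*L L≤L*L) ⟩
    L * L + L * L + (L * L + L * L) ≡⟨ four-copies ⟩
    4 * (L * L)                 ≡⟨ cong (4 *_) (^-distribˡ-+-* 2 d d) ⟨
    4 * 2 ^ (d + d)             ≡⟨ cong (λ e → 4 * 2 ^ (d + e)) (+-identityʳ d) ⟨
    rounds                      ∎
    where
    open ≤-Reasoning
    L≤L*L : L ≤ L * L
    L≤L*L = m≤m*n L L {{m^n≢0 2 d}}
    four-copies : L * L + L * L + (L * L + L * L) ≡ 4 * (L * L)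
    four-copies = trans (+-assoc (L * L) (L * L) _) (cong (λ x → L * L + (L * L + x)) (cong (L * L +_) (sym (+-identityʳ (L * L)))))

  tail : ℕ
  tail = rounds ∸ T L

  T+tail≡rounds : T L + tail ≡ rounds
  T+tail≡rounds = m+[n∸m]≡n (m+n≤o⇒m≤o (T L) schedule-fits)

  2L≤tail : L + L ≤ tail
  2L≤tail = m+n≤o⇒m≤o∸n (L + L) (subst (_≤ rounds) (+-comm (T L) (L + L)) schedule-fits)

  R-rounds≡post : ∀ v → R rounds v ≡ post tail v
  R-rounds≡post v = cong (λ t → R t v) (sym T+tail≡rounds)

  messages-bounded : MessagesBounded algorithm G ids d rounds (5 * suc k)
  messages-bounded t _ v u _ = ≤-reflexive (begin
    length (encode (width (size (run algorithm G ids d t u))) (fields (messageTo (run algorithm G ids d t u) (ids v))))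
      ≡⟨ length-encode (width (size (run algorithm G ids d t u))) (fields (messageTo (run algorithm G ids d t u) (ids v))) ⟩
    5 * width (size (run algorithm G ids d t u))
      ≡⟨ cong (λ s → 5 * width (size s)) (sym (R≡run t u)) ⟩
    5 * width (size (R t u))   ≡⟨ cong (λ m → 5 * width m) (size-R t u) ⟩
    5 * (suc k * suc c)        ≡⟨ *-assoc 5 (suc k) (suc c) ⟨
    5 * suc k * suc c          ≡⟨ cong (5 * suc k *_) (+-comm 1 c) ⟩
    5 * suc k * (c + 1)        ∎)
    where
    open ≡-Reasoning
    c = ⌈log₂ N ⌉

  L>0 : 0 < L
  L>0 = m^n>0 2 d

  outputOf-tree : ∀ s {p D} → alarm s ≡ false → (if parentId s ≡ᵇ sentinel s then nothing else just (parentId s)) ≡ p → height s ≡ D →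
                  outputOf s ≡ tree p (childIds s) D
  outputOf-tree s quiet-s p≡ D≡ rewrite quiet-s | p≡ | D≡ = refl

  output-at-end : ∀ v → output algorithm (run algorithm G ids d rounds v) ≡ outputOf (post tail v)
  output-at-end v = cong outputOf (trans (sym (R≡run rounds v)) (R-rounds≡post v))

  module NoAlarm (quiet : ∀ x → alarm (atPhase L x) ≡ false) where

    no-failure-at-end : ∀ x → failed (atPhase L x) ≡ false
    no-failure-at-end x = ∨-conicalˡ _ _ (trans (sym (alarm-final x)) (quiet x))

    settled-at-end : ∀ x → Settled L x
    settled-at-end x = ∨-conicalʳ _ _ (trans (sym (alarm-final x)) (quiet x))

    consistent-everywhere : ∀ j (j<L : j < L) → AllConsistent j j<L
    consistent-everywhere j j<L v = proj₂ (Transition.failed-next≡false⇒ j v j<L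
      (no-failure-before (L ∸ suc j) (suc j) v (≤-reflexive eq) (subst (λ t → failed (atPhase t v) ≡ false) (sym eq) (no-failure-at-end v))))
      where eq = m+[n∸m]≡n j<L

    invariant : ∀ j → j ≤ L → Invariant j
    invariant zero    _   = invariant-zero
    invariant (suc j) j<L = InvariantStep.invariant-suc j j<L (consistent-everywhere j j<L) (invariant j (<⇒≤ j<L))

    open Invariant (invariant L ≤-refl)

    depth-Lvl : ∀ m v → depth (atPhase L v) ≡ m → Lvl parent v m
    depth-Lvl zero    v e = ⊥-elim (1+n≰n (≤-trans (proj₁ (settled-link v (settled-at-end v))) (≤-reflexive e)))
    depth-Lvl (suc m) v e with settled-link v (settled-at-end v)
    ... | _ , _ , inj₁ (p≡∞ , d≡1) = subst (Lvl parent v) (trans (sym d≡1) e) (root (findId-none (nbrs G v) (λ {u} _ eu → ids≢∞ u (trans eu p≡∞))))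
    ... | _ , _ , inj₂ (u , u∈ , eu , _ , du) = up (findId-complete (nbrs G v) u∈ eu) (depth-Lvl m u (suc-injective (trans du e)))

    parent-forest : IsForest parent
    parent-forest v = depth (atPhase L v) , depth-Lvl _ v refl

    open Agreement 0 L>0 (consistent-everywhere 0 L>0)

    elected-zero-connected : ∀ {v w} → Star (Adj G) v w → elected 0 v ≡ elected 0 w
    elected-zero-connected ε                  = refl
    elected-zero-connected {v} (w∈ ◅ path) = trans (sym (neighbours-agree (active-zero v) (active-zero _) w∈)) (elected-zero-connected path)

    root⇒parentId≡∞ : ∀ v → parent v ≡ nothing → parentId (atPhase L v) ≡ ∞
    root⇒parentId≡∞ v e with settled-link v (settled-at-end v)
    ... | _ , _ , inj₁ (p≡∞ , _) = p≡∞
    ... | _ , _ , inj₂ (u , u∈ , eu , _ , _) with () ← trans (sym e) (findId-complete (nbrs G v) u∈ eu)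

    parentId-output : ∀ v → (if parentId (atPhase L v) ≡ᵇ ∞ then nothing else just (parentId (atPhase L v))) ≡ Maybe.map ids (parent v)
    parentId-output v with settled-link v (settled-at-end v)
    ... | _ , _ , inj₁ (p≡∞ , _) rewrite p≡∞ | ≡⇒≡ᵇ≡true {∞} refl
          | findId-none (nbrs G v) {∞} (λ {u} _ eu → ids≢∞ u eu) = refl
    ... | _ , _ , inj₂ (u , u∈ , eu , _ , _) rewrite findId-complete (nbrs G v) u∈ eu | sym eu | ≢⇒≡ᵇ≡false (ids≢∞ u) = refl

    module Spanning (conn : Connected G) where

      root-unique : ∀ v w → parent v ≡ nothing → parent w ≡ nothing → v ≡ w
      root-unique v w rv rw = ids-injective (trans (sym (root-elected v (settled-at-end v) (root⇒parentId≡∞ v rv)))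
                                (trans (elected-zero-connected (conn v w)) (root-elected w (settled-at-end w) (root⇒parentId≡∞ w rw))))

      parent-tree : IsTree parent
      parent-tree = parent-forest , r , r-root , λ v e → root-unique v r e r-root
        where
        r = proj₁ (Forest.Lvl⇒root parent (depth-Lvl _ zero refl))
        r-root = proj₂ (Forest.Lvl⇒root parent (depth-Lvl _ zero refl))

      parent-vertical : EdgesVertical G parent
      parent-vertical u v u~v with proj₂ (settled-vertical v u u~v (settled-at-end v)) (settled-at-end u)
      ... | inj₁ v≤u = inj₂ v≤u
      ... | inj₂ u≤v = inj₁ u≤v

      -- both ends reach, within L steps, the vertex whose identifier phase 0 elected
      diameter≤2L : ∀ v w → Reach (Adj G) (L + L) v w
      diameter≤2L v w with elected-source v (active-zero v) | elected-source w (active-zero w)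
      ... | y , _ , _ , r , e | y′ , _ , _ , r′ , e′ with ids-injective (trans (sym e) (trans (elected-zero-connected (conn v w)) e′))
      ...   | refl = Reach-++ (Reach-map proj₁ r) (Reach-reverse (λ {x} {y} x~y → Graph.sym G y x x~y) (Reach-map proj₁ r′))

      depth≤N : ∀ x → depth (atPhase L x) ≤ N
      depth≤N x with settled-chain L (invariant L ≤-refl) _ x (settled-at-end x) refl
      ... | xs , len , uniq , _ , _ = subst (_≤ N) len (Unique⇒length≤ (x ∷ xs) uniq)

      open HeightFlooding (λ x → subst (_≤ N) (sym (height-final x)) (depth≤N x))

      treeDepth : ℕ
      treeDepth = height (post tail zero)

      height-end : ∀ v → height (post tail v) ≡ treeDepth
      height-end v = ≤-antisym (≤-trans (≤-reflexive (proj₂ (height-attained tail v))) (height≤ zero _))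
                               (≤-trans (≤-reflexive (proj₂ (height-attained tail zero))) (height≤ v _))
        where
        height≤ : ∀ v x → height (atPhase L x) ≤ height (post tail v)
        height≤ v x = height-spreads tail (Reach-weaken 2L≤tail (diameter≤2L v x))

      has-depth : HasDepth parent treeDepth
      has-depth = (λ v m l → subst (_≤ treeDepth) (Forest.Lvl-functional parent (depth-Lvl _ v refl) l)
                                   (subst (_≤ treeDepth) (height-final v) (height-spreads tail (Reach-weaken 2L≤tail (diameter≤2L zero v))))) ,
                  y , depth-Lvl treeDepth y (trans (sym (height-final y)) (sym (proj₂ (height-attained tail zero))))
        where y = proj₁ (height-attained tail zero)

      treeDepth≤2^d : treeDepth ≤ 2 ^ d
      treeDepth≤2^d = ≤-trans (≤-reflexive (trans (proj₂ (height-attained tail zero)) (height-final y)))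
                              (proj₁ (proj₂ (settled-link y (settled-at-end y))))
        where y = proj₁ (height-attained tail zero)

      tail′ : ℕ
      tail′ = pred tail

      1+tail′≡tail : suc tail′ ≡ tail
      1+tail′≡tail = suc-pred tail {{>-nonZero (≤-trans L>0 (≤-trans (m≤m+n L L) 2L≤tail))}}

      children-iff : ∀ v x → (x ∈ childIds (post tail v)) ⇔ (Σ (Fin N) λ c → parent c ≡ just v × ids c ≡ x)
      children-iff v x = mk⇔ sound complete
        where
        sound : x ∈ childIds (post tail v) → Σ (Fin N) λ c → parent c ≡ just v × ids c ≡ x
        sound x∈ with children-sound tail′ v (subst (λ r → x ∈ childIds (post r v)) (sym 1+tail′≡tail) x∈)
        ... | u , u∈ , eu , pu = u , findId-complete (nbrs G u) (Graph.sym G u v u∈) (sym pu) , eu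
        complete : (Σ (Fin N) λ c → parent c ≡ just v × ids c ≡ x) → x ∈ childIds (post tail v)
        complete (c , pc , ec) with findId-sound (nbrs G c) pc
        ... | v∈ , ev = subst (λ r → x ∈ childIds (post r v)) 1+tail′≡tail
                          (subst (_∈ childIds (post (suc tail′) v)) ec (children-complete tail′ v (Graph.sym G v c v∈) (sym ev)))

      output-end : ∀ v → outputOf (post tail v) ≡ tree (Maybe.map ids (parent v)) (childIds (post tail v)) treeDepth
      output-end v = outputOf-tree (post tail v) (no-alarm-post quiet tail v)
        (trans (cong₂ (λ p i → if p ≡ᵇ i then nothing else just p) (parentId-post tail v) (cong (_^ k) (size-R (T L + tail) v))) (parentId-output v))
        (height-end v)

      correct : CorrectOutput G ids d (λ v → output algorithm (run algorithm G ids d rounds v))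
      correct = inj₂ (parent , (parent-tree , parent-vertical) , treeDepth , has-depth , treeDepth≤2^d ,
                      λ v → childIds (post tail v) , trans (output-at-end v) (output-end v) , children-iff v)

  module Alarmed (conn : Connected G) (x₀ : Fin N) (alarm-x₀ : alarm (atPhase L x₀) ≡ true) where

    td>d : TdGreater G d
    td>d (q , elim , depth≤d) = true≢false (trans (sym alarm-x₀) (Shallow.no-alarm q elim depth≤d x₀))

    -- phase 0 ran consistently on the 2L-ball of a vertex that heard of no alarm, and that ball is closed under neighbours
    module Quiet (v : Fin N) (quiet-v : alarm (post (L + L) v) ≡ false) where

      no-alarm-near : ∀ {y} → Reach (Adj G) (L + L) v y → alarm (atPhase L y) ≡ false
      no-alarm-near {y} r with Bool-dichotomy (alarm (atPhase L y))
      ... | inj₂ e = e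
      ... | inj₁ e = ⊥-elim (true≢false (trans (sym (alarm-spreads (L + L) r e)) quiet-v))

      consistent-near : ∀ {y} → Reach (Adj G) (L + L) v y → Transition.Consistent 0 y L>0
      consistent-near {y} r = proj₂ (Transition.failed-next≡false⇒ 0 y L>0
        (no-failure-before L′ 1 y (≤-reflexive 1+L′≡L) (subst (λ t → failed (atPhase t y) ≡ false) (sym 1+L′≡L) no-failure)))
        where
        no-failure : failed (atPhase L y) ≡ false
        no-failure = ∨-conicalˡ _ _ (trans (sym (alarm-final y)) (no-alarm-near r))

      agree-at : ∀ {y u} → Transition.Consistent 0 y L>0 → u ∈ nbrs G y → elected 0 u ≡ elected 0 y
      agree-at {y} {u} c u∈ =
        trans (sym (truncate-best (T 0 + L) u))
          (disagrees≡false⇒agree (λ u → ids u , received (R (T 0 + L) u) (ids y)) (elected 0 y) (nbrs G y) (proj₂ (c (active-zero y))) u∈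
            (trans (Flooding.active-during 0 L>0 L u ≤-refl) (active-zero u)))

      agree-along : ∀ {m k a y} → Reach (Adj G) m v a → Reach (Adj G) k a y → m + k ≤ L + L → elected 0 a ≡ elected 0 y
      agree-along ra stay _ = refl
      agree-along {m} {suc k} ra (move a~b r) m+k≤ =
        trans (sym (agree-at (consistent-near (Reach-weaken (≤-trans (m≤m+n m (suc k)) m+k≤) ra)) a~b))
              (agree-along (Reach-snoc ra a~b) r (≤-trans (≤-reflexive (sym (+-suc m k))) m+k≤))

      source : ∀ {y} → elected 0 y ≢ ∞ → Σ (Fin N) λ c → Reach (Adj G) L y c × elected 0 y ≡ ids c
      source {y} el≢∞ with Flooding.flood-source 0 L>0 L ≤-refl y (active-zero y)
      ... | inj₁ el≡∞                    = ⊥-elim (el≢∞ el≡∞)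
      ... | inj₂ (c , _ , _ , rc , e) = c , Reach-map proj₁ rc , e

      closed : ∀ {y z} → Reach (Adj G) (L + L) v y → z ∈ nbrs G y → Reach (Adj G) (L + L) v z
      closed {y} {z} r z∈ with source el≢∞ | source (λ e → el≢∞ (trans ev (trans (sym ez) e)))
        where
        ev : elected 0 v ≡ elected 0 y
        ev = agree-along {0} stay r ≤-refl
        ez : elected 0 z ≡ elected 0 y
        ez = agree-at (consistent-near r) z∈
        el≢∞ : elected 0 v ≢ ∞
        el≢∞ = proj₁ (consistent-near stay (active-zero v))
      ... | c , rvc , evc | c′ , rzc , ezc
        with ids-injective (trans (sym ezc) (trans (agree-at (consistent-near r) z∈) (trans (sym (agree-along {0} stay r ≤-refl)) evc)))
      ...   | refl = Reach-++ rvc (Reach-reverse (λ {x} {y} x~y → Graph.sym G y x x~y) rzc)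

      everywhere : ∀ {y} w → Reach (Adj G) (L + L) v y → Star (Adj G) y w → Reach (Adj G) (L + L) v w
      everywhere w r ε           = r
      everywhere w r (z∈ ◅ path) = everywhere w (closed r z∈) path

      impossible : ⊥
      impossible = true≢false (trans (sym alarm-x₀) (no-alarm-near (everywhere x₀ stay (conn v x₀))))

    alarm-persists : ∀ e r v → alarm (post r v) ≡ true → alarm (post (r + e) v) ≡ true
    alarm-persists zero    r v a = subst (λ t → alarm (post t v) ≡ true) (sym (+-identityʳ r)) a
    alarm-persists (suc e) r v a = subst (λ t → alarm (post t v) ≡ true) (sym (+-suc r e))
      (trans (alarm-post (r + e) v) (∨-trueˡ _ (alarm-persists e r v a)))

    alarm-end : ∀ v → alarm (post tail v) ≡ true
    alarm-end v with Bool-dichotomy (alarm (post (L + L) v))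
    ... | inj₁ a = subst (λ t → alarm (post t v) ≡ true) (m+[n∸m]≡n 2L≤tail) (alarm-persists (tail ∸ (L + L)) (L + L) v a)
    ... | inj₂ q = ⊥-elim (Quiet.impossible v q)

    correct : CorrectOutput G ids d (λ v → output algorithm (run algorithm G ids d rounds v))
    correct = inj₁ (td>d , λ v → trans (output-at-end v) (if-true (alarm-end v)))

  correct : Connected G → CorrectOutput G ids d (λ v → output algorithm (run algorithm G ids d rounds v))
  correct conn with any? (λ x → alarm (atPhase L x) ≟ᴮ true)
  ... | yes (x₀ , a) = Alarmed.correct conn x₀ a
  ... | no none      = NoAlarm.Spanning.correct quiet conn
    where
    quiet : ∀ x → alarm (atPhase L x) ≡ false
    quiet x with Bool-dichotomy (alarm (atPhase L x))
    ... | inj₁ e = ⊥-elim (none (x , e))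
    ... | inj₂ e = e

lemma11 : (k : ℕ) → Σ Algorithm λ A → Σ ℕ λ C → Σ ℕ λ B →
    (n : ℕ) (G : Graph (suc n)) → Connected G →
    (ids : Fin (suc n) → ℕ) → Injective _≡_ _≡_ ids → (∀ v → ids v < suc n ^ k) →
    (d : ℕ) → 1 ≤ d →
    MessagesBounded A G ids d (C * 2 ^ (2 * d)) B
    × CorrectOutput G ids d (λ v → output A (run A G ids d (C * 2 ^ (2 * d)) v))
lemma11 k = Protocol.algorithm k , 4 , 5 * suc k ,
  λ n G conn ids ids-injective ids<∞ d _ → let open Execution k n G ids ids-injective ids<∞ d in messages-bounded , correct conn
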